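{- Let $r\ge 2$ and $s\ge 1$ be integers and let $F$ be an $r$-graph with $\chi(F)>2$. Let $t=\min\{s,r-1\}$ and let $\mathcal{F}$ be the family of $r$-graphs obtained from $F$ by deleting a weakly independent set of vertices of $F$. Then for all sufficiently large $n$, $$\mathrm{ex}_r(n,\{F,M_{s+1}^r\})=\mathrm{ex}_r(s,\mathcal{F})+\sum_{i=1}^{t}\binom{s}{i}\binom{n-s}{r-i}.$$
   Context: An $r$-graph is a hypergraph all of whose hyperedges have exactly $r$ vertices. A weakly independent set of a hypergraph $H$ is a subset of $V(H)$ containing no hyperedge of $H$; deleting a vertex set removes those vertices and all hyperedges containing any of them. A proper $k$-coloring of $H$ is a map $V(H)\to\{1,\dots,k\}$ under which no hyperedge is monochromatic, and $\chi(H)$ is the least such $k$. $M_{s+1}^r$ denotes the $r$-graph consisting of $s+1$ pairwise disjoint hyperedges. For a family $\mathcal{F}$ of $r$-graphs, a hypergraph is $\mathcal{F}$-free if it contains no member of $\mathcal{F}$ as a subhypergraph, and $\mathrm{ex}_r(n,\mathcal{F})$ is the maximum number of hyperedges in an $\mathcal{F}$-free $r$-graph on $n$ vertices. -}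

module Defs where

open import Data.Nat using (ℕ; zero; suc; _+_; _*_; _∸_; _≤_)
open import Data.Nat.Combinatorics using (_C_)
open import Data.Fin using (Fin; quotient)
open import Data.Fin.Properties using (_≟_)
open import Data.Fin.Subset using (Subset; _∈_; _∉_; _⊆_; ∣_∣; ⊤; ∁)
open import Data.Vec using (tabulate)
open import Data.List using (List; length; map; allFin)
open import Data.List.Relation.Unary.All using (All)
open import Data.List.Relation.Unary.Unique.Propositional using (Unique)
open import Data.List.Membership.Propositional renaming (_∈_ to _∈ₗ_)
open import Data.Product using (Σ; ∃; ∃-syntax; _×_; _,_; proj₁)
open import Data.Empty using (⊥)
open import Relation.Nullary using (¬_; ⌊_⌋)
open import Relation.Binary.PropositionalEquality using (_≡_; _≢_)
open import Function.Bundles using (_⇔_)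

-- A hypergraph on the vertex set Fin n: a list of hyperedges, each hyperedge
-- being a subset of Fin n.  (Being a set of hyperedges, i.e. having no
-- repeated entry, is imposed separately by RGraph.)
record Hypergraph (n : ℕ) : Set where
  constructor mkHypergraph
  field
    edges  : List (Subset n)
open Hypergraph public

e : ∀ {n} → Hypergraph n → ℕ
e H = length (edges H)

Uniform : ℕ → ∀ {n} → Hypergraph n → Set
Uniform r H = All (λ f → ∣ f ∣ ≡ r) (edges H)

RGraph : ℕ → ∀ {n} → Hypergraph n → Set
RGraph r H = Uniform r H × Unique (edges H)

-- Copy of the hypergraph G restricted to the kept vertex set K
-- (i.e. G with the vertices outside K and all hyperedges meeting them deleted)
-- inside H: an injective map φ from the kept vertices of G into V(H) sending
-- every hyperedge of G contained in K onto a hyperedge of H.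
ContainsOn : ∀ {m n} → Hypergraph m → Subset m → Hypergraph n → Set
ContainsOn {m} {n} G K H =
  Σ (Σ (Fin m) (λ i → i ∈ K) → Fin n) λ φ →
    (∀ x y → φ x ≡ φ y → proj₁ x ≡ proj₁ y) ×
    (∀ f → f ∈ₗ edges G → f ⊆ K →
       ∃[ g ] (g ∈ₗ edges H ×
         (∀ j → (j ∈ g) ⇔ (∃[ x ] (proj₁ x ∈ f × φ x ≡ j)))))

_⊑_ : ∀ {m n} → Hypergraph m → Hypergraph n → Set
G ⊑ H = ContainsOn G ⊤ H

WeaklyIndependent : ∀ {m} → Hypergraph m → Subset m → Set
WeaklyIndependent G S = ∀ f → f ∈ₗ edges G → ¬ (f ⊆ S)

ContainsDeletion : ∀ {m n} → Hypergraph m → Subset m → Hypergraph n → Set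
ContainsDeletion F S H = ContainsOn F (∁ S) H

ProperColoring : ∀ {m} (k : ℕ) → Hypergraph m → (Fin m → Fin k) → Set
ProperColoring k G c =
  ∀ f → f ∈ₗ edges G → ∃[ i ] ∃[ j ] (i ∈ f × j ∈ f × c i ≢ c j)

ChromaticGreaterThan : ∀ {m} → Hypergraph m → ℕ → Set
ChromaticGreaterThan {m} G k =
  ∀ l → l ≤ k → ¬ (Σ (Fin m → Fin l) (ProperColoring l G))

-- The matching M^r_{t}: vertex set Fin (t·r), the k-th hyperedge is the
-- k-th block of r consecutive vertices.
Matching : (t r : ℕ) → Hypergraph (t * r)
Matching t r =
  mkHypergraph (map (λ k → tabulate (λ i → ⌊ quotient r i ≟ k ⌋)) (allFin t))

-- The family 𝓕 of the r-graphs F − S, S a weakly independent set of F.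
-- H is 𝓕-free iff it contains no F − S.
FreeOfDeletions : ∀ {m n} → Hypergraph m → Hypergraph n → Set
FreeOfDeletions F H =
  ∀ S → WeaklyIndependent F S → ¬ ContainsDeletion F S H

FreeOfFAndMatching : ∀ {m n} (r s : ℕ) → Hypergraph m → Hypergraph n → Set
FreeOfFAndMatching r s F H = ¬ (F ⊑ H) × ¬ (Matching (suc s) r ⊑ H)

IsEx : (r n : ℕ) → (Hypergraph n → Set) → ℕ → Set
IsEx r n P N =
  (∃[ H ] (RGraph r H × P H × e H ≡ N)) ×
  (∀ H → RGraph r H → P H → e H ≤ N)

sum1 : ℕ → (ℕ → ℕ) → ℕ
sum1 zero    f = 0
sum1 (suc t) f = sum1 t f + f (suc t)

-- Lower bound: take an extremal 𝓕-free r-graph G on s vertices and add every r-set meeting these s core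
-- vertices in between 1 and min(s, r − 1) vertices. Every edge meets the core, so there are no s + 1 disjoint
-- edges; and in a copy of F the vertices sent outside the core form a weakly independent set S (every edge of
-- the construction meets the core) while the edges of F − S land inside the core, i.e. in G.
--
-- Upper bound: let H be {F, M^r_{s+1}}-free on n vertices and call a vertex heavy if its degree exceeds
-- r s C(n, r − 2). A heavy vertex has an edge avoiding any r s given vertices, so the heavy vertices together
-- with a greedy matching avoiding them number at most s. If fewer than s vertices are heavy, every edge meets
-- one of them or the matching, so e(H) ≤ (s − 1) C(n, r − 1) + O(n^(r−2)), which is below the i = 1 term
-- s C(n − s, r − 1) for large n. Otherwise the s heavy vertices B meet every edge. Edges meeting B in i < r
-- vertices number at most C(s, i) C(n − s, r − i). Edges inside B number at most ex_r(s, 𝓕) unless H[B]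
-- contains some F − S; then, since F ⊄ H, mapping S to fresh vertices outside B over and over yields C(s, r)
-- distinct non-edges meeting B in 1 to r − 1 vertices, and these pay for all the edges inside B.

{-# OPTIONS --safe #-}
module Submission where

open import Defs
open import Data.Nat using (ℕ; zero; suc; _+_; _*_; _∸_; _^_; _⊓_; _≤_; _<_; _≥_; _≤?_; _<?_; z≤n; s≤s; s≤s⁻¹)
open import Data.Nat.Properties hiding (_≟_)
open import Data.Nat.Combinatorics using (_C_; nCk≡nC[n∸k]; nCn≡1; nC1≡n; nCk+nC[k+1]≡[n+1]C[k+1]; k>n⇒nCk≡0)
open import Data.Nat.ListAction using (sum)
open import Data.Nat.Solver using (module +-*-Solver)
open import Data.Bool using (true; false; if_then_else_)
import Data.Bool.Properties as Bool
open import Data.Fin using (Fin; zero; suc; _↑ˡ_; _↑ʳ_; splitAt; inject≤; quotient; remainder; remQuot; combine; cast)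
  renaming (_<_ to _<ᶠ_)
open import Data.Fin.Properties
  using (any?; all?; _≟_; pigeonhole; remQuot-combine; combine-remQuot; cast-involutive; inject≤-injective;
         ↑ˡ-injective; splitAt-↑ˡ; splitAt-↑ʳ; splitAt⁻¹-↑ˡ; splitAt⁻¹-↑ʳ)
import Data.Fin.Properties as Fin
open import Data.Fin.Subset using (Subset; _∈_; _∉_; _⊆_; ∣_∣; ⊤; ⊥; ∁; _∩_; _-_; ⁅_⁆; Nonempty; inside; outside)
open import Data.Fin.Subset.Properties
open import Data.Vec using ([]; _∷_; tabulate; here; there) renaming (_++_ to _++ᵛ_)
import Data.Vec.Properties as Vec
open import Data.Vec.Properties.WithK using ([]=-irrelevant)
open import Data.List
  using (List; []; _∷_; _++_; _∷ʳ_; length; map; filter; take; lookup; allFin; applyUpTo; cartesianProduct; cartesianProductWith)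
open import Data.List.Properties using (length-map; length-++; length-take; length-tabulate; map-cong; applyUpTo-∷ʳ; filter-++)
open import Data.List.Extrema.Nat using (argmax; argmax-all; f[xs]≤f[argmax])
open import Data.List.Relation.Unary.All as All using (All; []; _∷_)
import Data.List.Relation.Unary.All.Properties as All
open import Data.List.Relation.Unary.AllPairs using (AllPairs; []; _∷_)
import Data.List.Relation.Unary.AllPairs.Properties as AllPairs
open import Data.List.Relation.Unary.Any as Any using (here; there)
open import Data.List.Relation.Unary.Unique.Propositional using (Unique)
import Data.List.Relation.Unary.Unique.Propositional.Properties as Unique
open import Data.List.Relation.Binary.Subset.Propositional using () renaming (_⊆_ to _⊆ₗ_)
open import Data.List.Membership.Propositional using (find; lose) renaming (_∈_ to _∈ₗ_; _∉_ to _∉ₗ_)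
open import Data.List.Membership.Propositional.Properties
  using (∈-∃++; ∈-++⁻; ∈-++⁺ˡ; ∈-++⁺ʳ; ∈-map⁺; ∈-map⁻; ∈-filter⁺; ∈-filter⁻; ∈-allFin; ∈-lookup; ∈-applyUpTo⁺;
         ∈-cartesianProduct⁺; ∈-cartesianProductWith⁻)
open import Data.Product using (Σ; Σ-syntax; ∃; ∃₂; ∃-syntax; _×_; _,_; proj₁; proj₂)
open import Data.Sum using (_⊎_; inj₁; inj₂)
open import Data.Empty using (⊥-elim)
open import Function.Bundles using (mk⇔; Equivalence)
open import Relation.Nullary using (¬_; Dec; yes; no; does; ⌊_⌋; contradiction)
open import Relation.Nullary.Decidable using (_×-dec_; _→-dec_; ¬?; map′; isYes≗does; dec-true)
open import Relation.Unary using (Decidable)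
open import Relation.Binary.PropositionalEquality using (_≡_; _≢_; refl; sym; trans; cong; cong₂; subst; module ≡-Reasoning)

open +-*-Solver using (solve; _:+_; _:*_; con; _:=_)

private variable m n : ℕ

-- Binomial coefficients

nC0≡1 : ∀ n → n C 0 ≡ 1
nC0≡1 n = trans (nCk≡nC[n∸k] {k = 0} {n = n} z≤n) (nCn≡1 n)

pascal : ∀ n k → suc n C suc k ≡ n C k + n C suc k
pascal n k = sym (nCk+nC[k+1]≡[n+1]C[k+1] n k)

nCk≤[1+n]Ck : ∀ n k → n C k ≤ suc n C k
nCk≤[1+n]Ck n zero    = ≤-reflexive (trans (nC0≡1 n) (sym (nC0≡1 (suc n))))
nCk≤[1+n]Ck n (suc k) = subst (n C suc k ≤_) (sym (pascal n k)) (m≤n+m _ _)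

[k+1]*nC[k+1]+k*nCk≡n*nCk : ∀ n k → suc k * (n C suc k) + k * (n C k) ≡ n * (n C k)
[k+1]*nC[k+1]+k*nCk≡n*nCk zero zero = refl
[k+1]*nC[k+1]+k*nCk≡n*nCk zero (suc k)
  rewrite k>n⇒nCk≡0 {0} {suc k} (s≤s z≤n) | k>n⇒nCk≡0 {0} {suc (suc k)} (s≤s z≤n)
        | *-zeroʳ (suc (suc k)) = refl
[k+1]*nC[k+1]+k*nCk≡n*nCk (suc n) zero = begin
  1 * (suc n C 1) + 0 * (suc n C 0) ≡⟨ cong₂ (λ u v → 1 * u + 0 * v) (nC1≡n (suc n)) (nC0≡1 (suc n)) ⟩
  1 * suc n + 0 * 1              ≡⟨ solve 1 (λ n → con 1 :* n :+ con 0 :* con 1 := n :* con 1) refl (suc n) ⟩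
  suc n * 1                      ≡⟨ cong (suc n *_) (nC0≡1 (suc n)) ⟨
  suc n * (suc n C 0)            ∎
  where open ≡-Reasoning
[k+1]*nC[k+1]+k*nCk≡n*nCk (suc n) (suc k)
  rewrite pascal n (suc k) | pascal n k =
  begin
    (2 + k) * (b + c) + (1 + k) * (a + b)
      ≡⟨ solve 4 (λ k A B C → (con 2 :+ k) :* (B :+ C) :+ (con 1 :+ k) :* (A :+ B)
                   := A :+ B :+ ((con 1 :+ k) :* B :+ k :* A) :+ ((con 2 :+ k) :* C :+ (con 1 :+ k) :* B)) refl k a b c ⟩
    a + b + (suc k * b + k * a) + (suc (suc k) * c + suc k * b)
      ≡⟨ cong₂ (λ u v → a + b + u + v) ([k+1]*nC[k+1]+k*nCk≡n*nCk n k) ([k+1]*nC[k+1]+k*nCk≡n*nCk n (suc k)) ⟩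
    a + b + n * a + n * b
      ≡⟨ solve 3 (λ A B n → A :+ B :+ n :* A :+ n :* B := (con 1 :+ n) :* (A :+ B)) refl a b n ⟩
    suc n * (a + b) ∎
  where
  open ≡-Reasoning
  a b c : ℕ
  a = n C k
  b = n C suc k
  c = n C suc (suc k)

nCk≤nC[k+1] : ∀ n k → suc (2 * k) ≤ n → n C k ≤ n C suc k
nCk≤nC[k+1] n k 2k<n = *-cancelˡ-≤ (suc k) (+-cancelʳ-≤ (k * a) (suc k * a) (suc k * b) (begin
  suc k * a + k * a  ≡⟨ *-distribʳ-+ a (suc k) k ⟨
  (suc k + k) * a    ≤⟨ *-monoˡ-≤ a (≤-trans (≤-reflexive (cong suc (cong (k +_) (sym (+-identityʳ k))))) 2k<n) ⟩
  n * a              ≡⟨ [k+1]*nC[k+1]+k*nCk≡n*nCk n k ⟨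
  suc k * b + k * a  ∎))
  where
  open ≤-Reasoning
  a b : ℕ
  a = n C k
  b = n C suc k

[1+n]Ck≤2*nCk : ∀ n k → 2 * k ≤ n → suc n C k ≤ 2 * (n C k)
[1+n]Ck≤2*nCk n zero _ rewrite nC0≡1 (suc n) | nC0≡1 n = s≤s z≤n
[1+n]Ck≤2*nCk n (suc k) 2k+2≤n = begin
  suc n C suc k              ≡⟨ pascal n k ⟩
  n C k + n C suc k          ≤⟨ +-monoˡ-≤ (n C suc k) (nCk≤nC[k+1] n k 2k+1≤n) ⟩
  n C suc k + n C suc k      ≡⟨ cong (n C suc k +_) (+-identityʳ (n C suc k)) ⟨
  2 * (n C suc k)            ∎
  where
  open ≤-Reasoning
  2k+1≤n : suc (2 * k) ≤ n
  2k+1≤n = ≤-trans (n≤1+n _) (subst (_≤ n) (*-suc 2 k) 2k+2≤n)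

[d+n]Ck≤2^d*nCk : ∀ d n k → 2 * k ≤ n → (d + n) C k ≤ 2 ^ d * (n C k)
[d+n]Ck≤2^d*nCk zero    n k _   = ≤-reflexive (sym (+-identityʳ (n C k)))
[d+n]Ck≤2^d*nCk (suc d) n k 2k≤n = begin
  suc (d + n) C k            ≤⟨ [1+n]Ck≤2*nCk (d + n) k (≤-trans 2k≤n (m≤n+m n d)) ⟩
  2 * ((d + n) C k)          ≤⟨ *-monoʳ-≤ 2 ([d+n]Ck≤2^d*nCk d n k 2k≤n) ⟩
  2 * (2 ^ d * (n C k))      ≡⟨ *-assoc 2 (2 ^ d) (n C k) ⟨
  2 ^ suc d * (n C k)        ∎
  where open ≤-Reasoning

t*nCk≤[k+1]*nC[k+1] : ∀ n k t → k + t ≤ n → t * (n C k) ≤ suc k * (n C suc k)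
t*nCk≤[k+1]*nC[k+1] n k t k+t≤n = +-cancelˡ-≤ (k * a) (t * a) (suc k * (n C suc k)) (begin
  k * a + t * a                  ≡⟨ *-distribʳ-+ a k t ⟨
  (k + t) * a                    ≤⟨ *-monoˡ-≤ a k+t≤n ⟩
  n * a                          ≡⟨ [k+1]*nC[k+1]+k*nCk≡n*nCk n k ⟨
  suc k * (n C suc k) + k * a    ≡⟨ +-comm (suc k * (n C suc k)) (k * a) ⟩
  k * a + suc k * (n C suc k)    ∎)
  where
  open ≤-Reasoning
  a : ℕ
  a = n C k

c*[d+n]Ck≤nC[k+1] : ∀ c d n k → 2 * k + suc k * (c * 2 ^ d) ≤ n → c * ((d + n) C k) ≤ n C suc k
c*[d+n]Ck≤nC[k+1] c d n k big = *-cancelˡ-≤ (suc k) (begin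
  suc k * (c * ((d + n) C k))        ≤⟨ *-monoʳ-≤ (suc k) (*-monoʳ-≤ c ([d+n]Ck≤2^d*nCk d n k 2k≤n)) ⟩
  suc k * (c * (2 ^ d * (n C k)))    ≡⟨ solve 4 (λ k c e a → k :* (c :* (e :* a)) := (k :* (c :* e)) :* a)
                                               refl (suc k) c (2 ^ d) (n C k) ⟩
  t * (n C k)                        ≤⟨ t*nCk≤[k+1]*nC[k+1] n k t (≤-trans (+-monoˡ-≤ t (m≤n+m k k)) k+k+t≤n) ⟩
  suc k * (n C suc k)                ∎)
  where
  open ≤-Reasoning
  t = suc k * (c * 2 ^ d)
  k+k+t≤n : k + k + t ≤ n
  k+k+t≤n = subst (λ x → x + t ≤ n) (cong (k +_) (+-identityʳ k)) big
  2k≤n : 2 * k ≤ n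
  2k≤n = ≤-trans (m≤m+n (2 * k) t) big

[d+n]C[k+1]≤nC[k+1]+d*[d+n]Ck : ∀ d n k → (d + n) C suc k ≤ n C suc k + d * ((d + n) C k)
[d+n]C[k+1]≤nC[k+1]+d*[d+n]Ck zero    n k = m≤m+n (n C suc k) 0
[d+n]C[k+1]≤nC[k+1]+d*[d+n]Ck (suc d) n k = begin
  suc (d + n) C suc k                          ≡⟨ pascal (d + n) k ⟩
  a + (d + n) C suc k                          ≤⟨ +-monoʳ-≤ a ([d+n]C[k+1]≤nC[k+1]+d*[d+n]Ck d n k) ⟩
  a + (n C suc k + d * a)                      ≡⟨ solve 3 (λ a b d → a :+ (b :+ d :* a) := b :+ (a :+ d :* a))
                                                         refl a (n C suc k) d ⟩
  n C suc k + (a + d * a)                      ≤⟨ +-monoʳ-≤ (n C suc k) (*-monoʳ-≤ (suc d) (nCk≤[1+n]Ck (d + n) k)) ⟩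
  n C suc k + suc d * ((suc d + n) C k)        ∎
  where
  open ≤-Reasoning
  a : ℕ
  a = (d + n) C k

-- Counting with lists

module _ {A : Set} where

  Unique∧⊆⇒length≤ : ∀ {xs ys : List A} → Unique xs → xs ⊆ₗ ys → length xs ≤ length ys
  Unique∧⊆⇒length≤ {[]}     _            _  = z≤n
  Unique∧⊆⇒length≤ {x ∷ xs} {ys} (x∉xs ∷ u) xs⊆ys with ∈-∃++ (xs⊆ys (here refl))
  ... | us , vs , refl = begin
    suc (length xs)           ≤⟨ s≤s (Unique∧⊆⇒length≤ u xs⊆us++vs) ⟩
    suc (length (us ++ vs))   ≡⟨ cong suc (length-++ us) ⟩
    suc (length us + length vs) ≡⟨ +-suc (length us) (length vs) ⟨
    length us + length (x ∷ vs) ≡⟨ length-++ us ⟨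
    length (us ++ x ∷ vs)     ∎
    where
    open ≤-Reasoning
    xs⊆us++vs : xs ⊆ₗ us ++ vs
    xs⊆us++vs {y} y∈xs with ∈-++⁻ us (xs⊆ys (there y∈xs))
    ... | inj₁ y∈us         = ∈-++⁺ˡ y∈us
    ... | inj₂ (here refl)  = contradiction refl (All.lookup x∉xs y∈xs)
    ... | inj₂ (there y∈vs) = ∈-++⁺ʳ us y∈vs

module _ {A B : Set} (f : A → B) where

  InjectiveOn : List A → Set
  InjectiveOn xs = ∀ {x y} → x ∈ₗ xs → y ∈ₗ xs → f x ≡ f y → x ≡ y

  Unique-map⁺ : ∀ {xs} → InjectiveOn xs → Unique xs → Unique (map f xs)
  Unique-map⁺ {[]}     _   []         = []
  Unique-map⁺ {x ∷ xs} inj (x∉xs ∷ u) =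
    All.map⁺ (All.tabulate (λ y∈xs fx≡fy → All.lookup x∉xs y∈xs (inj (here refl) (there y∈xs) fx≡fy)))
    ∷ Unique-map⁺ (λ p q → inj (there p) (there q)) u

  injectiveOn⇒length≤ : ∀ {xs ys} → Unique xs → InjectiveOn xs → (∀ {x} → x ∈ₗ xs → f x ∈ₗ ys) →
                        length xs ≤ length ys
  injectiveOn⇒length≤ {xs} {ys} u inj f∈ =
    subst (_≤ length ys) (length-map f xs) (Unique∧⊆⇒length≤ (Unique-map⁺ inj u) fxs⊆ys)
    where
    fxs⊆ys : map f xs ⊆ₗ ys
    fxs⊆ys p with ∈-map⁻ f p
    ... | x , x∈xs , refl = f∈ x∈xs

length-cartesianProductWith : ∀ {A B C : Set} (f : A → B → C) xs ys →
                              length (cartesianProductWith f xs ys) ≡ length xs * length ys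
length-cartesianProductWith f []       ys = refl
length-cartesianProductWith f (x ∷ xs) ys =
  trans (length-++ (map (f x) ys)) (cong₂ _+_ (length-map (f x) ys) (length-cartesianProductWith f xs ys))

module _ {B : Set} where

  ∑ : List B → (B → ℕ) → ℕ
  ∑ X g = sum (map g X)

  ∑-mono : ∀ X {g h : B → ℕ} → (∀ {b} → b ∈ₗ X → g b ≤ h b) → ∑ X g ≤ ∑ X h
  ∑-mono []      g≤h = z≤n
  ∑-mono (b ∷ X) g≤h = +-mono-≤ (g≤h (here refl)) (∑-mono X (λ p → g≤h (there p)))

  ∑-+ : ∀ X (g h : B → ℕ) → ∑ X (λ b → g b + h b) ≡ ∑ X g + ∑ X h
  ∑-+ []      g h = refl
  ∑-+ (b ∷ X) g h rewrite ∑-+ X g h =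
    solve 4 (λ x y u v → x :+ y :+ (u :+ v) := x :+ u :+ (y :+ v)) refl (g b) (h b) (∑ X g) (∑ X h)

  ∑-const : ∀ X c → ∑ X (λ _ → c) ≡ length X * c
  ∑-const []      c = refl
  ∑-const (b ∷ X) c = cong (c +_) (∑-const X c)

  ∑-++ : ∀ X Y (g : B → ℕ) → ∑ (X ++ Y) g ≡ ∑ X g + ∑ Y g
  ∑-++ []      Y g = refl
  ∑-++ (b ∷ X) Y g = trans (cong (g b +_) (∑-++ X Y g)) (sym (+-assoc (g b) _ _))

  ≤∑ : ∀ X (g : B → ℕ) {b} → b ∈ₗ X → g b ≤ ∑ X g
  ≤∑ (b ∷ X) g (here refl) = m≤m+n (g b) _
  ≤∑ (b ∷ X) g (there p)   = ≤-trans (≤∑ X g p) (m≤n+m _ (g b))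

module _ {A B : Set} {R : B → A → Set} (R? : ∀ b a → Dec (R b a)) where

  private
    count : List A → B → ℕ
    count L b = length (filter (R? b) L)

    [R]+count : ∀ a L b → (if does (R? b a) then 1 else 0) + count L b ≡ count (a ∷ L) b
    [R]+count a L b with R? b a
    ... | yes _ = refl
    ... | no  _ = refl

  length≤∑-count : ∀ (L : List A) X → (∀ {a} → a ∈ₗ L → ∃[ b ] (b ∈ₗ X × R b a)) →
                   length L ≤ ∑ X (count L)
  length≤∑-count []      X cov = z≤n
  length≤∑-count (a ∷ L) X cov with cov (here refl)
  ... | b , b∈X , Rba = begin
    1 + length L                                   ≤⟨ +-mono-≤ one (length≤∑-count L X (λ p → cov (there p))) ⟩
    ∑ X [R] + ∑ X (count L)                        ≡⟨ ∑-+ X [R] (count L) ⟨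
    ∑ X (λ b → [R] b + count L b)                  ≡⟨ cong sum (map-cong ([R]+count a L) X) ⟩
    ∑ X (count (a ∷ L))                            ∎
    where
    open ≤-Reasoning
    [R] : B → ℕ
    [R] b = if does (R? b a) then 1 else 0
    one : 1 ≤ ∑ X [R]
    one with R? b a | ≤∑ X [R] b∈X
    ... | yes _ | le = le
    ... | no ¬R | _  = contradiction Rba ¬R

-- Finite subsets

x∈p⇒1≤∣p∣ : ∀ {p : Subset n} {x} → x ∈ p → 1 ≤ ∣ p ∣
x∈p⇒1≤∣p∣ {x = x} x∈p =
  subst (_≤ _) (∣⁅x⁆∣≡1 x) (p⊆q⇒∣p∣≤∣q∣ (λ y∈⁅x⁆ → subst (_∈ _) (sym (x∈⁅y⁆⇒x≡y _ y∈⁅x⁆)) x∈p))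

1≤∣p∣⇒Nonempty : ∀ (p : Subset n) → 1 ≤ ∣ p ∣ → Nonempty p
1≤∣p∣⇒Nonempty (inside  ∷ p) _  = zero , here
1≤∣p∣⇒Nonempty (outside ∷ p) 1≤ with 1≤∣p∣⇒Nonempty p 1≤
... | x , x∈p = suc x , there x∈p

¬⊆⇒∃∉ : ∀ {p q : Subset n} → ¬ (p ⊆ q) → ∃[ x ] (x ∈ p × x ∉ q)
¬⊆⇒∃∉ {p = p} {q} p⊈q with any? (λ x → (x ∈? p) ×-dec ¬? (x ∈? q))
... | yes w   = w
... | no  ¬w  = ⊥-elim (p⊈q p⊆q)
  where
  p⊆q : p ⊆ q
  p⊆q {x} x∈p with x ∈? q
  ... | yes x∈q = x∈q
  ... | no  x∉q = contradiction (x , x∈p , x∉q) ¬w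

∣p∩q∣+∣p∩∁q∣≡∣p∣ : ∀ (p q : Subset n) → ∣ p ∩ q ∣ + ∣ p ∩ ∁ q ∣ ≡ ∣ p ∣
∣p∩q∣+∣p∩∁q∣≡∣p∣ []            []            = refl
∣p∩q∣+∣p∩∁q∣≡∣p∣ (inside  ∷ p) (inside  ∷ q) = cong suc (∣p∩q∣+∣p∩∁q∣≡∣p∣ p q)
∣p∩q∣+∣p∩∁q∣≡∣p∣ (inside  ∷ p) (outside ∷ q) = trans (+-suc _ _) (cong suc (∣p∩q∣+∣p∩∁q∣≡∣p∣ p q))
∣p∩q∣+∣p∩∁q∣≡∣p∣ (outside ∷ p) (inside  ∷ q) = ∣p∩q∣+∣p∩∁q∣≡∣p∣ p q
∣p∩q∣+∣p∩∁q∣≡∣p∣ (outside ∷ p) (outside ∷ q) = ∣p∩q∣+∣p∩∁q∣≡∣p∣ p q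

∣p∩q∣≡∣p∣⇒p⊆q : ∀ (p q : Subset n) → ∣ p ∩ q ∣ ≡ ∣ p ∣ → p ⊆ q
∣p∩q∣≡∣p∣⇒p⊆q p q eq {x} x∈p with x ∈? q
... | yes x∈q = x∈q
... | no  x∉q = contradiction (≤-reflexive ∣p∩∁q∣≡0) (<⇒≱ (x∈p⇒1≤∣p∣ (x∈p∩q⁺ (x∈p , x∉p⇒x∈∁p x∉q))))
  where
  ∣p∩∁q∣≡0 : ∣ p ∩ ∁ q ∣ ≡ 0
  ∣p∩∁q∣≡0 = +-cancelˡ-≡ ∣ p ∩ q ∣ _ 0 (trans (∣p∩q∣+∣p∩∁q∣≡∣p∣ p q) (trans (sym eq) (sym (+-identityʳ _))))

∣p-x∣+1≡∣p∣ : ∀ (p : Subset n) {x} → x ∈ p → suc ∣ p - x ∣ ≡ ∣ p ∣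
∣p-x∣+1≡∣p∣ (inside  ∷ p) {zero}  here         = cong suc (cong ∣_∣ (p─⊥≡p p))
∣p-x∣+1≡∣p∣ (inside  ∷ p) {suc x} (there x∈p) = cong suc (∣p-x∣+1≡∣p∣ p x∈p)
∣p-x∣+1≡∣p∣ (outside ∷ p) {suc x} (there x∈p) = ∣p-x∣+1≡∣p∣ p x∈p

-x-injective : ∀ {p q : Subset n} {x} → x ∈ p → x ∈ q → p - x ≡ q - x → p ≡ q
-x-injective {p = p} {q} {x} x∈p x∈q eq = ⊆-antisym (⊆ x∈q eq) (⊆ x∈p (sym eq))
  where
  ⊆ : ∀ {p q} → x ∈ q → p - x ≡ q - x → p ⊆ q
  ⊆ {p} {q} x∈q eq {y} y∈p with y ≟ x
  ... | yes refl = x∈q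
  ... | no  y≢x  = p─q⊆p q ⁅ x ⁆ (subst (y ∈_) eq (x∈p∧x≢y⇒x∈p-y y∈p y≢x))

elements : Subset n → List (Fin n)
elements []            = []
elements (inside  ∷ p) = zero ∷ map suc (elements p)
elements (outside ∷ p) = map suc (elements p)

∈-elements⁺ : ∀ (p : Subset n) {x} → x ∈ p → x ∈ₗ elements p
∈-elements⁺ (inside  ∷ p) here        = here refl
∈-elements⁺ (inside  ∷ p) (there x∈p) = there (∈-map⁺ suc (∈-elements⁺ p x∈p))
∈-elements⁺ (outside ∷ p) (there x∈p) = ∈-map⁺ suc (∈-elements⁺ p x∈p)

∈-elements⁻ : ∀ (p : Subset n) {x} → x ∈ₗ elements p → x ∈ p
∈-elements⁻ (inside  ∷ p) (here refl) = here
∈-elements⁻ (inside  ∷ p) (there x∈)  with ∈-map⁻ suc x∈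
... | y , y∈ , refl = there (∈-elements⁻ p y∈)
∈-elements⁻ (outside ∷ p) x∈          with ∈-map⁻ suc x∈
... | y , y∈ , refl = there (∈-elements⁻ p y∈)

length-elements : ∀ (p : Subset n) → length (elements p) ≡ ∣ p ∣
length-elements []            = refl
length-elements (inside  ∷ p) = cong suc (trans (length-map suc (elements p)) (length-elements p))
length-elements (outside ∷ p) = trans (length-map suc (elements p)) (length-elements p)

elements-Unique : ∀ (p : Subset n) → Unique (elements p)
elements-Unique []            = []
elements-Unique (inside  ∷ p) = zero∉ (elements p) ∷ Unique.map⁺ Fin.suc-injective (elements-Unique p)
  where
  zero∉ : ∀ (xs : List (Fin _)) → All (zero ≢_) (map suc xs)
  zero∉ []       = []
  zero∉ (x ∷ xs) = (λ ()) ∷ zero∉ xs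
elements-Unique (outside ∷ p) = Unique.map⁺ Fin.suc-injective (elements-Unique p)

∣p∣≡length : ∀ (p : Subset n) {xs} → Unique xs → (∀ {x} → x ∈ₗ xs → x ∈ p) → (∀ {x} → x ∈ p → x ∈ₗ xs) →
             ∣ p ∣ ≡ length xs
∣p∣≡length p {xs} u xs⊆p p⊆xs = ≤-antisym
  (subst (_≤ length xs) (length-elements p)
    (Unique∧⊆⇒length≤ (elements-Unique p) (λ x∈ → p⊆xs (∈-elements⁻ p x∈))))
  (subst (length xs ≤_) (length-elements p) (Unique∧⊆⇒length≤ u (λ x∈ → ∈-elements⁺ p (xs⊆p x∈))))

enum : ∀ (B : Subset n) → Fin ∣ B ∣ → Fin n
enum (inside  ∷ B) zero    = zero
enum (inside  ∷ B) (suc k) = suc (enum B k)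
enum (outside ∷ B) k       = suc (enum B k)

enum-∈ : ∀ (B : Subset n) k → enum B k ∈ B
enum-∈ (inside  ∷ B) zero    = here
enum-∈ (inside  ∷ B) (suc k) = there (enum-∈ B k)
enum-∈ (outside ∷ B) k       = there (enum-∈ B k)

enum-injective : ∀ (B : Subset n) {k l} → enum B k ≡ enum B l → k ≡ l
enum-injective (inside  ∷ B) {zero}  {zero}  _  = refl
enum-injective (inside  ∷ B) {suc k} {suc l} eq = cong suc (enum-injective B (Fin.suc-injective eq))
enum-injective (outside ∷ B)                 eq = enum-injective B (Fin.suc-injective eq)

enum-surjective : ∀ (B : Subset n) {x} → x ∈ B → ∃[ k ] enum B k ≡ x
enum-surjective (inside  ∷ B) here        = zero , refl
enum-surjective (inside  ∷ B) (there x∈B) with enum-surjective B x∈B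
... | k , refl = suc k , refl
enum-surjective (outside ∷ B) (there x∈B) with enum-surjective B x∈B
... | k , refl = k , refl

restrict : ∀ (B : Subset n) → Subset n → Subset ∣ B ∣
restrict []            []      = []
restrict (inside  ∷ B) (b ∷ f) = b ∷ restrict B f
restrict (outside ∷ B) (b ∷ f) = restrict B f

restrict-∈⁻ : ∀ (B f : Subset n) {k} → k ∈ restrict B f → enum B k ∈ f
restrict-∈⁻ (inside  ∷ B) (b ∷ f) {zero}  here      = here
restrict-∈⁻ (inside  ∷ B) (b ∷ f) {suc k} (there k∈) = there (restrict-∈⁻ B f k∈)
restrict-∈⁻ (outside ∷ B) (b ∷ f)         k∈         = there (restrict-∈⁻ B f k∈)

restrict-∈⁺ : ∀ (B f : Subset n) {k} → enum B k ∈ f → k ∈ restrict B f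
restrict-∈⁺ (inside  ∷ B) (b ∷ f) {zero}  here       = here
restrict-∈⁺ (inside  ∷ B) (b ∷ f) {suc k} (there k∈) = there (restrict-∈⁺ B f k∈)
restrict-∈⁺ (outside ∷ B) (b ∷ f)         (there k∈) = restrict-∈⁺ B f k∈

∣restrict∣ : ∀ (B f : Subset n) → f ⊆ B → ∣ restrict B f ∣ ≡ ∣ f ∣
∣restrict∣ []            []            _   = refl
∣restrict∣ (inside  ∷ B) (inside  ∷ f) f⊆B = cong suc (∣restrict∣ B f (drop-∷-⊆ f⊆B))
∣restrict∣ (inside  ∷ B) (outside ∷ f) f⊆B = ∣restrict∣ B f (drop-∷-⊆ f⊆B)
∣restrict∣ (outside ∷ B) (inside  ∷ f) f⊆B with f⊆B here
... | ()
∣restrict∣ (outside ∷ B) (outside ∷ f) f⊆B = ∣restrict∣ B f (drop-∷-⊆ f⊆B)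

restrict-injective : ∀ (B : Subset n) {f g} → f ⊆ B → g ⊆ B → restrict B f ≡ restrict B g → f ≡ g
restrict-injective B f⊆B g⊆B eq = ⊆-antisym (⊆ f⊆B eq) (⊆ g⊆B (sym eq))
  where
  ⊆ : ∀ {f g} → f ⊆ B → restrict B f ≡ restrict B g → f ⊆ g
  ⊆ {f} {g} f⊆B eq x∈f with enum-surjective B (f⊆B x∈f)
  ... | k , refl = restrict-∈⁻ B g (subst (k ∈_) eq (restrict-∈⁺ B f x∈f))

choose : ∀ (B : Subset n) → ℕ → List (Subset n)
choose []            zero    = [] ∷ []
choose []            (suc k) = []
choose (outside ∷ B) k       = map (outside ∷_) (choose B k)
choose (inside  ∷ B) zero    = map (outside ∷_) (choose B zero)
choose (inside  ∷ B) (suc k) = map (inside ∷_) (choose B k) ++ map (outside ∷_) (choose B (suc k))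

length-choose : ∀ (B : Subset n) k → length (choose B k) ≡ ∣ B ∣ C k
length-choose []            zero    = refl
length-choose []            (suc k) = refl
length-choose (outside ∷ B) k       = trans (length-map _ (choose B k)) (length-choose B k)
length-choose (inside  ∷ B) zero    =
  trans (length-map _ (choose B zero)) (trans (length-choose B zero) (trans (nC0≡1 ∣ B ∣) (sym (nC0≡1 (suc ∣ B ∣)))))
length-choose (inside  ∷ B) (suc k) = begin
  length (map (inside ∷_) (choose B k) ++ map (outside ∷_) (choose B (suc k)))
    ≡⟨ length-++ (map (inside ∷_) (choose B k)) ⟩
  length (map (inside ∷_) (choose B k)) + length (map (outside ∷_) (choose B (suc k)))
    ≡⟨ cong₂ _+_ (length-map _ (choose B k)) (length-map _ (choose B (suc k))) ⟩
  length (choose B k) + length (choose B (suc k))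
    ≡⟨ cong₂ _+_ (length-choose B k) (length-choose B (suc k)) ⟩
  ∣ B ∣ C k + ∣ B ∣ C suc k
    ≡⟨ pascal ∣ B ∣ k ⟨
  suc ∣ B ∣ C suc k ∎
  where open ≡-Reasoning

∈-choose⁺ : ∀ (B : Subset n) {f} k → f ⊆ B → ∣ f ∣ ≡ k → f ∈ₗ choose B k
∈-choose⁺ []            {[]}          zero    _   _  = here refl
∈-choose⁺ (outside ∷ B) {inside  ∷ f} k       f⊆B _  with f⊆B here
... | ()
∈-choose⁺ (outside ∷ B) {outside ∷ f} k       f⊆B eq = ∈-map⁺ _ (∈-choose⁺ B k (drop-∷-⊆ f⊆B) eq)
∈-choose⁺ (inside  ∷ B) {inside  ∷ f} (suc k) f⊆B eq =
  ∈-++⁺ˡ (∈-map⁺ _ (∈-choose⁺ B k (drop-∷-⊆ f⊆B) (suc-injective eq)))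
∈-choose⁺ (inside  ∷ B) {outside ∷ f} zero    f⊆B eq = ∈-map⁺ _ (∈-choose⁺ B zero (drop-∷-⊆ f⊆B) eq)
∈-choose⁺ (inside  ∷ B) {outside ∷ f} (suc k) f⊆B eq =
  ∈-++⁺ʳ (map (inside ∷_) (choose B k)) (∈-map⁺ _ (∈-choose⁺ B (suc k) (drop-∷-⊆ f⊆B) eq))

∈-choose⁻ : ∀ (B : Subset n) k {f} → f ∈ₗ choose B k → f ⊆ B × ∣ f ∣ ≡ k
∈-choose⁻ []            zero    (here refl) = (λ ()) , refl
∈-choose⁻ (outside ∷ B) k       f∈ with ∈-map⁻ _ f∈
... | g , g∈ , refl = let (g⊆B , eq) = ∈-choose⁻ B k g∈ in (λ { (there x∈) → there (g⊆B x∈) }) , eq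
∈-choose⁻ (inside  ∷ B) zero    f∈ with ∈-map⁻ _ f∈
... | g , g∈ , refl = let (g⊆B , eq) = ∈-choose⁻ B zero g∈ in (λ { (there x∈) → there (g⊆B x∈) }) , eq
∈-choose⁻ (inside  ∷ B) (suc k) f∈ with ∈-++⁻ (map (inside ∷_) (choose B k)) f∈
... | inj₁ f∈ˡ with ∈-map⁻ _ f∈ˡ
...   | g , g∈ , refl = let (g⊆B , eq) = ∈-choose⁻ B k g∈ in
                        (λ { here → here ; (there x∈) → there (g⊆B x∈) }) , cong suc eq
∈-choose⁻ (inside  ∷ B) (suc k) f∈ | inj₂ f∈ʳ with ∈-map⁻ _ f∈ʳ
...   | g , g∈ , refl = let (g⊆B , eq) = ∈-choose⁻ B (suc k) g∈ in (λ { (there x∈) → there (g⊆B x∈) }) , eq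

choose-Unique : ∀ (B : Subset n) k → Unique (choose B k)
choose-Unique []            zero    = [] ∷ []
choose-Unique []            (suc k) = []
choose-Unique (outside ∷ B) k       = Unique.map⁺ Vec.∷-injectiveʳ (choose-Unique B k)
choose-Unique (inside  ∷ B) zero    = Unique.map⁺ Vec.∷-injectiveʳ (choose-Unique B zero)
choose-Unique (inside  ∷ B) (suc k) =
  Unique.++⁺ (Unique.map⁺ Vec.∷-injectiveʳ (choose-Unique B k))
             (Unique.map⁺ Vec.∷-injectiveʳ (choose-Unique B (suc k))) disjoint
  where
  disjoint : ∀ {f} → ¬ (f ∈ₗ map (inside ∷_) (choose B k) × f ∈ₗ map (outside ∷_) (choose B (suc k)))
  disjoint (f∈ˡ , f∈ʳ) with ∈-map⁻ _ f∈ˡ | ∈-map⁻ _ f∈ʳ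
  ... | _ , _ , refl | _ , _ , ()

subsetOf : ∀ {P : Fin n → Set} → Decidable P → Subset n
subsetOf P? = tabulate (λ x → ⌊ P? x ⌋)

module _ {P : Fin n → Set} (P? : Decidable P) where

  ∈-subsetOf⁻ : ∀ {x} → x ∈ subsetOf P? → P x
  ∈-subsetOf⁻ {x} x∈ with P? x | trans (sym (Vec.lookup∘tabulate (λ x → ⌊ P? x ⌋) x)) (Vec.[]=⇒lookup x∈)
  ... | yes Px | _ = Px

  ∈-subsetOf⁺ : ∀ {x} → P x → x ∈ subsetOf P?
  ∈-subsetOf⁺ {x} Px = Vec.lookup⇒[]= x _ 
    (trans (Vec.lookup∘tabulate (λ x → ⌊ P? x ⌋) x) (trans (isYes≗does (P? x)) (dec-true (P? x) Px)))

inImage? : ∀ (Φ : Fin m → Fin n) f → Decidable (λ y → ∃[ x ] (x ∈ f × Φ x ≡ y))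
inImage? Φ f y = any? (λ x → (x ∈? f) ×-dec (Φ x ≟ y))

image : (Fin m → Fin n) → Subset m → Subset n
image Φ f = subsetOf (inImage? Φ f)

module _ (Φ : Fin m → Fin n) (f : Subset m) where

  ∈-image⁺ : ∀ {x} → x ∈ f → Φ x ∈ image Φ f
  ∈-image⁺ {x} x∈f = ∈-subsetOf⁺ (inImage? Φ f) (x , x∈f , refl)

  ∈-image⁻ : ∀ {y} → y ∈ image Φ f → ∃[ x ] (x ∈ f × Φ x ≡ y)
  ∈-image⁻ = ∈-subsetOf⁻ (inImage? Φ f)

  ∣image∣ : (∀ {x y} → Φ x ≡ Φ y → x ≡ y) → ∣ image Φ f ∣ ≡ ∣ f ∣
  ∣image∣ Φ-inj = begin
    ∣ image Φ f ∣               ≡⟨ ∣p∣≡length (image Φ f) (Unique.map⁺ Φ-inj (elements-Unique f)) ⊆image image⊆ ⟩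
    length (map Φ (elements f)) ≡⟨ length-map Φ (elements f) ⟩
    length (elements f)         ≡⟨ length-elements f ⟩
    ∣ f ∣                       ∎
    where
    open ≡-Reasoning
    ⊆image : ∀ {y} → y ∈ₗ map Φ (elements f) → y ∈ image Φ f
    ⊆image y∈ with ∈-map⁻ Φ y∈
    ... | x , x∈ , refl = ∈-image⁺ (∈-elements⁻ f x∈)
    image⊆ : ∀ {y} → y ∈ image Φ f → y ∈ₗ map Φ (elements f)
    image⊆ y∈ with ∈-image⁻ y∈
    ... | x , x∈f , refl = ∈-map⁺ Φ (∈-elements⁺ f x∈f)

image-cong : ∀ {Φ Ψ : Fin m → Fin n} (f : Subset m) → (∀ x → Φ x ≡ Ψ x) → image Φ f ≡ image Ψ f
image-cong {Φ = Φ} {Ψ} f Φ≗Ψ = ⊆-antisym (⊆ Φ Ψ Φ≗Ψ) (⊆ Ψ Φ (λ x → sym (Φ≗Ψ x)))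
  where
  ⊆ : ∀ Φ Ψ → (∀ x → Φ x ≡ Ψ x) → image Φ f ⊆ image Ψ f
  ⊆ Φ Ψ Φ≗Ψ y∈ with ∈-image⁻ Φ f y∈
  ... | x , x∈f , refl = subst (_∈ image Ψ f) (sym (Φ≗Ψ x)) (∈-image⁺ Ψ f x∈f)

-- Embeddings, decidability and the existence of ex

IsEmbeddingOn : Hypergraph m → Subset m → Hypergraph n → (Fin m → Fin n) → Set
IsEmbeddingOn G K H Φ =
  (∀ i j → i ∈ K → j ∈ K → Φ i ≡ Φ j → i ≡ j) ×
  (∀ f → f ∈ₗ edges G → f ⊆ K → image Φ f ∈ₗ edges H)

module _ (G : Hypergraph m) (K : Subset m) (H : Hypergraph n) where

  embeddingOn⇒containsOn : ∀ {Φ} → IsEmbeddingOn G K H Φ → ContainsOn G K H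
  embeddingOn⇒containsOn {Φ} (Φ-inj , Φ-edge) =
    (λ x → Φ (proj₁ x)) ,
    (λ x y → Φ-inj (proj₁ x) (proj₁ y) (proj₂ x) (proj₂ y)) ,
    λ f f∈G f⊆K → image Φ f , Φ-edge f f∈G f⊆K , λ j → mk⇔
      (λ j∈ → let (i , i∈f , Φi≡j) = ∈-image⁻ Φ f j∈ in (i , f⊆K i∈f) , i∈f , Φi≡j)
      (λ { ((i , _) , i∈f , refl) → ∈-image⁺ Φ f i∈f })

  extension-isEmbeddingOn : ∀ (c : ContainsOn G K H) Φ → (∀ i (i∈K : i ∈ K) → Φ i ≡ proj₁ c (i , i∈K)) →
                            IsEmbeddingOn G K H Φ
  extension-isEmbeddingOn (φ , φ-inj , φ-edge) Φ Φ≡φ = Φ-inj , Φ-edge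
    where
    Φ-inj : ∀ i j → i ∈ K → j ∈ K → Φ i ≡ Φ j → i ≡ j
    Φ-inj i j i∈K j∈K eq = φ-inj (i , i∈K) (j , j∈K) (trans (sym (Φ≡φ i i∈K)) (trans eq (Φ≡φ j j∈K)))
    Φ-edge : ∀ f → f ∈ₗ edges G → f ⊆ K → image Φ f ∈ₗ edges H
    Φ-edge f f∈G f⊆K with φ-edge f f∈G f⊆K
    ... | g , g∈H , g≡φf = subst (_∈ₗ edges H) (⊆-antisym g⊆ ⊆g) g∈H
      where
      g⊆ : g ⊆ image Φ f
      g⊆ j∈g with Equivalence.to (g≡φf _) j∈g
      ... | (i , i∈K) , i∈f , refl = subst (_∈ image Φ f) (Φ≡φ i i∈K) (∈-image⁺ Φ f i∈f)
      ⊆g : image Φ f ⊆ g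
      ⊆g j∈ with ∈-image⁻ Φ f j∈
      ... | i , i∈f , refl = Equivalence.from (g≡φf _) ((i , f⊆K i∈f) , i∈f , sym (Φ≡φ i (f⊆K i∈f)))

  containsOn⇒embeddingOn : Fin n → ContainsOn G K H → ∃ (IsEmbeddingOn G K H)
  containsOn⇒embeddingOn default c@(φ , _) = Φ , extension-isEmbeddingOn c Φ Φ≡φ
    where
    Φ : Fin m → Fin n
    Φ i with i ∈? K
    ... | yes i∈K = φ (i , i∈K)
    ... | no  _   = default
    Φ≡φ : ∀ i (i∈K : i ∈ K) → Φ i ≡ φ (i , i∈K)
    Φ≡φ i i∈K with i ∈? K
    ... | yes i∈K′ = cong (λ p → φ (i , p)) ([]=-irrelevant i∈K′ i∈K)
    ... | no  i∉K  = contradiction i∈K i∉K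

⊑⇒embedding : ∀ {G : Hypergraph m} {H : Hypergraph n} → G ⊑ H → ∃ (IsEmbeddingOn G ⊤ H)
⊑⇒embedding {G = G} {H} c@(φ , _) =
  _ , extension-isEmbeddingOn G ⊤ H c (λ i → φ (i , ∈⊤)) (λ i i∈⊤ → cong (λ p → φ (i , p)) ([]=-irrelevant ∈⊤ i∈⊤))

containsOn-mono : ∀ {G : Hypergraph m} {K} {H H′ : Hypergraph n} → edges H ⊆ₗ edges H′ →
                  ContainsOn G K H → ContainsOn G K H′
containsOn-mono H⊆H′ (φ , φ-inj , φ-edge) =
  φ , φ-inj , λ f f∈G f⊆K → let (g , g∈H , g≡φf) = φ-edge f f∈G f⊆K in g , H⊆H′ g∈H , g≡φf

∃-fun? : ∀ m n {P : (Fin m → Fin n) → Set} → (∀ {Φ Ψ} → (∀ i → Φ i ≡ Ψ i) → P Φ → P Ψ) →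
         (∀ Φ → Dec (P Φ)) → Dec (∃ P)
∃-fun? zero n P-resp P? = map′ (λ p → _ , p) (λ (Φ , p) → P-resp (λ ()) p) (P? (λ ()))
∃-fun? (suc m) n {P} P-resp P? =
  map′ (λ (a , Ψ , p) → cons a Ψ , p)
       (λ (Φ , p) → Φ zero , (λ i → Φ (suc i)) , P-resp (λ { zero → refl ; (suc i) → refl }) p)
       (any? (λ a → ∃-fun? m n (λ Φ≗Ψ → P-resp (cons-cong a Φ≗Ψ)) (λ Ψ → P? (cons a Ψ))))
  where
  cons : Fin n → (Fin m → Fin n) → Fin (suc m) → Fin n
  cons a Ψ zero    = a
  cons a Ψ (suc i) = Ψ i
  cons-cong : ∀ a {Φ Ψ} → (∀ i → Φ i ≡ Ψ i) → ∀ i → cons a Φ i ≡ cons a Ψ i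
  cons-cong a Φ≗Ψ zero    = refl
  cons-cong a Φ≗Ψ (suc i) = Φ≗Ψ i

_∈ₗ?_ : ∀ (f : Subset n) (E : List (Subset n)) → Dec (f ∈ₗ E)
f ∈ₗ? E = Any.any? (Vec.≡-dec Bool._≟_ f) E

module _ (G : Hypergraph m) (K : Subset m) (H : Hypergraph n) where

  isEmbeddingOn? : ∀ Φ → Dec (IsEmbeddingOn G K H Φ)
  isEmbeddingOn? Φ = injective? ×-dec edges?
    where
    injective? : Dec (∀ i j → i ∈ K → j ∈ K → Φ i ≡ Φ j → i ≡ j)
    injective? = all? (λ i → all? (λ j → (i ∈? K) →-dec ((j ∈? K) →-dec ((Φ i ≟ Φ j) →-dec (i ≟ j)))))
    edges? : Dec (∀ f → f ∈ₗ edges G → f ⊆ K → image Φ f ∈ₗ edges H)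
    edges? = map′ (λ all f → All.lookup all) (λ h → All.tabulate (h _))
                  (All.all? (λ f → (f ⊆? K) →-dec (image Φ f ∈ₗ? edges H)) (edges G))

  isEmbeddingOn-cong : ∀ {Φ Ψ} → (∀ i → Φ i ≡ Ψ i) → IsEmbeddingOn G K H Φ → IsEmbeddingOn G K H Ψ
  isEmbeddingOn-cong Φ≗Ψ (Φ-inj , Φ-edge) =
    (λ i j i∈K j∈K eq → Φ-inj i j i∈K j∈K (trans (Φ≗Ψ i) (trans eq (sym (Φ≗Ψ j))))) ,
    λ f f∈G f⊆K → subst (_∈ₗ edges H) (image-cong f Φ≗Ψ) (Φ-edge f f∈G f⊆K)

  containsOn? : Fin n → Dec (ContainsOn G K H)
  containsOn? default =
    map′ (λ (Φ , emb) → embeddingOn⇒containsOn G K H emb) (containsOn⇒embeddingOn G K H default)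
         (∃-fun? m n isEmbeddingOn-cong isEmbeddingOn?)

weaklyIndependent? : ∀ (F : Hypergraph m) S → Dec (WeaklyIndependent F S)
weaklyIndependent? F S =
  map′ (λ all f → All.lookup all) (λ h → All.tabulate (h _)) (All.all? (λ f → ¬? (f ⊆? S)) (edges F))

deletion? : ∀ (F : Hypergraph m) (H : Hypergraph n) → Fin n →
            Dec (∃[ S ] (WeaklyIndependent F S × ContainsDeletion F S H))
deletion? F H default = anySubset? (λ S → weaklyIndependent? F S ×-dec containsOn? F (∁ S) H default)

freeOfDeletions? : ∀ (F : Hypergraph m) (H : Hypergraph n) → Fin n → Dec (FreeOfDeletions F H)
freeOfDeletions? F H default =
  map′ (λ ¬∃ S wi c → ¬∃ (S , wi , c)) (λ free (S , wi , c) → free S wi c) (¬? (deletion? F H default))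

module _ (F : Hypergraph m) (χF>2 : ChromaticGreaterThan F 2) where

  survivingEdge : ∀ S → WeaklyIndependent F S → ∃[ f ] (f ∈ₗ edges F × f ⊆ ∁ S)
  survivingEdge S S-wi with Any.any? (_⊆? ∁ S) (edges F)
  ... | yes ∃f = find ∃f
  ... | no  ∄f = ⊥-elim (χF>2 2 ≤-refl (colour , proper))
    where
    colour : Fin m → Fin 2
    colour i = if does (i ∈? S) then zero else suc zero
    colour-∈ : ∀ {i} → i ∈ S → colour i ≡ zero
    colour-∈ {i} i∈S with i ∈? S
    ... | yes _   = refl
    ... | no  i∉S = contradiction i∈S i∉S
    colour-∉ : ∀ {i} → i ∉ S → colour i ≡ suc zero
    colour-∉ {i} i∉S with i ∈? S
    ... | yes i∈S = contradiction i∈S i∉S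
    ... | no  _   = refl
    proper : ProperColoring 2 F colour
    proper f f∈F with ¬⊆⇒∃∉ (S-wi f f∈F) | ¬⊆⇒∃∉ (λ f⊆∁S → ∄f (lose f∈F f⊆∁S))
    ... | i , i∈f , i∉S | j , j∈f , j∉∁S =
      i , j , i∈f , j∈f , λ eq → 1≢0 (trans (sym (colour-∉ i∉S)) (trans eq (colour-∈ (x∉∁p⇒x∈p j∉∁S))))
      where
      1≢0 : suc zero ≢ zero {1}
      1≢0 ()

  emptyHypergraph-freeOfDeletions : ∀ {n} → FreeOfDeletions F (mkHypergraph {n} [])
  emptyHypergraph-freeOfDeletions S S-wi (φ , _ , φ-edge) with survivingEdge S S-wi
  ... | f , f∈F , f⊆∁S with φ-edge f f∈F f⊆∁S
  ... | _ , () , _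

module _ {A : Set} where

  sublists : List A → List (List A)
  sublists []       = [] ∷ []
  sublists (x ∷ xs) = map (x ∷_) (sublists xs) ++ sublists xs

  ∈-sublists⇒⊆ : ∀ xs {ys} → ys ∈ₗ sublists xs → ys ⊆ₗ xs
  ∈-sublists⇒⊆ []       (here refl) ()
  ∈-sublists⇒⊆ (x ∷ xs) ys∈ y∈ys with ∈-++⁻ (map (x ∷_) (sublists xs)) ys∈
  ... | inj₂ ys∈′ = there (∈-sublists⇒⊆ xs ys∈′ y∈ys)
  ... | inj₁ ys∈′ with ∈-map⁻ (x ∷_) ys∈′ | y∈ys
  ...   | zs , zs∈ , refl | here refl  = here refl
  ...   | zs , zs∈ , refl | there y∈zs = there (∈-sublists⇒⊆ xs zs∈ y∈zs)

  ∈-sublists⇒Unique : ∀ {xs ys} → ys ∈ₗ sublists xs → Unique xs → Unique ys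
  ∈-sublists⇒Unique {[]}     (here refl) _            = []
  ∈-sublists⇒Unique {x ∷ xs} ys∈         (x∉xs ∷ u) with ∈-++⁻ (map (x ∷_) (sublists xs)) ys∈
  ... | inj₂ ys∈′ = ∈-sublists⇒Unique ys∈′ u
  ... | inj₁ ys∈′ with ∈-map⁻ (x ∷_) ys∈′
  ...   | zs , zs∈ , refl =
    All.tabulate (λ z∈zs → All.lookup x∉xs (∈-sublists⇒⊆ xs zs∈ z∈zs)) ∷ ∈-sublists⇒Unique zs∈ u

  filter∈sublists : ∀ {P : A → Set} (P? : ∀ x → Dec (P x)) xs → filter P? xs ∈ₗ sublists xs
  filter∈sublists P? []       = here refl
  filter∈sublists P? (x ∷ xs) with does (P? x)
  ... | true  = ∈-++⁺ˡ (∈-map⁺ (x ∷_) (filter∈sublists P? xs))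
  ... | false = ∈-++⁺ʳ (map (x ∷_) (sublists xs)) (filter∈sublists P? xs)

-- The maximum is taken over the sublists of the list of all r-subsets of Fin n.
ex-exists : ∀ r n (P : Hypergraph n → Set) → (∀ H → Dec (P H)) → P (mkHypergraph []) →
            (∀ {G H} → edges G ⊆ₗ edges H → P H → P G) → ∃[ N ] IsEx r n P N
ex-exists r n P P? P[] P-hereditary = length best , (mkHypergraph best , best-rGraph , P-best , refl) , maximal
  where
  rSets : List (Subset n)
  rSets = choose ⊤ r
  P′ : List (Subset n) → Set
  P′ E = P (mkHypergraph E)
  candidates : List (List (Subset n))
  candidates = filter (λ E → P? (mkHypergraph E)) (sublists rSets)
  best : List (Subset n)
  best = argmax length [] candidates
  P-best : P′ best
  P-best = argmax-all length P[] (All.all-filter (λ E → P? (mkHypergraph E)) (sublists rSets))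
  best-rGraph : RGraph r (mkHypergraph best)
  best-rGraph = argmax-all length {P = λ E → RGraph r (mkHypergraph E)} ([] , [])
    (All.filter⁺ (λ E → P? (mkHypergraph E)) (All.tabulate (λ E∈ →
      All.tabulate (λ f∈ → proj₂ (∈-choose⁻ ⊤ r (∈-sublists⇒⊆ rSets E∈ f∈))) ,
      ∈-sublists⇒Unique E∈ (choose-Unique ⊤ r))))
  maximal : ∀ H → RGraph r H → P H → e H ≤ length best
  maximal H (H-uniform , H-unique) PH = ≤-trans
    (Unique∧⊆⇒length≤ H-unique (λ f∈H → ∈-filter⁺ (_∈ₗ? edges H) (∈-choose⁺ ⊤ r (λ _ → ∈⊤) (All.lookup H-uniform f∈H)) f∈H))
    (All.lookup (f[xs]≤f[argmax] {f = length} [] candidates)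
      (∈-filter⁺ (λ E → P? (mkHypergraph E)) (filter∈sublists (_∈ₗ? edges H) rSets)
        (P-hereditary (λ f∈ → proj₂ (∈-filter⁻ (_∈ₗ? edges H) {xs = rSets} f∈)) PH)))

ex-FreeOfDeletions : ∀ r s (F : Hypergraph m) → ChromaticGreaterThan F 2 → ∃[ a ] IsEx r (suc s) (FreeOfDeletions F) a
ex-FreeOfDeletions r s F χF>2 =
  ex-exists r (suc s) (FreeOfDeletions F) (λ G → freeOfDeletions? F G zero) (emptyHypergraph-freeOfDeletions F χF>2)
    (λ G⊆H H-free S S-wi F-S⊑G → H-free S S-wi (containsOn-mono G⊆H F-S⊑G))

-- Matchings

Disjoint : Subset n → Subset n → Set
Disjoint p q = ∀ {x} → x ∈ p → x ∉ q

block : ∀ t r → Fin t → Subset (t * r)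
block t r k = subsetOf (λ i → quotient r i ≟ k)

module _ {t r : ℕ} where

  ∈-Matching⁻ : ∀ {f} → f ∈ₗ edges (Matching t r) → ∃[ k ] f ≡ block t r k
  ∈-Matching⁻ f∈ with ∈-map⁻ (block t r) f∈
  ... | k , _ , f≡ = k , f≡

  block∈Matching : ∀ k → block t r k ∈ₗ edges (Matching t r)
  block∈Matching k = ∈-map⁺ (block t r) (∈-allFin k)

  ∈-block⁻ : ∀ {k i} → i ∈ block t r k → quotient r i ≡ k
  ∈-block⁻ = ∈-subsetOf⁻ (λ i → quotient r i ≟ _)

  ∈-block⁺ : ∀ {k i} → quotient r i ≡ k → i ∈ block t r k
  ∈-block⁺ = ∈-subsetOf⁺ (λ i → quotient r i ≟ _)

-- The c-th vertex of the k-th edge is the image of the c-th vertex of the k-th block.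
disjointEdges⇒Matching⊑ : ∀ t r (H : Hypergraph n) (M : Fin t → Subset n) →
  (∀ k → M k ∈ₗ edges H) → (∀ k → ∣ M k ∣ ≡ r) → (∀ {k l x} → x ∈ M k → x ∈ M l → k ≡ l) →
  Matching t r ⊑ H
disjointEdges⇒Matching⊑ {n} t r H M M∈H ∣M∣≡r M-disjoint =
  embeddingOn⇒containsOn (Matching t r) ⊤ H (Φ-injective , Φ-edge)
  where
  vertex : Fin t → Fin r → Fin n
  vertex k c = enum (M k) (cast (sym (∣M∣≡r k)) c)
  vertex-injective : ∀ k {c d} → vertex k c ≡ vertex k d → c ≡ d
  vertex-injective k {c} {d} eq = begin
    c                                              ≡⟨ cast-involutive (∣M∣≡r k) (sym (∣M∣≡r k)) c ⟨
    cast (∣M∣≡r k) (cast (sym (∣M∣≡r k)) c)        ≡⟨ cong (cast (∣M∣≡r k)) (enum-injective (M k) eq) ⟩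
    cast (∣M∣≡r k) (cast (sym (∣M∣≡r k)) d)        ≡⟨ cast-involutive (∣M∣≡r k) (sym (∣M∣≡r k)) d ⟩
    d                                              ∎
    where open ≡-Reasoning
  Φ : Fin (t * r) → Fin n
  Φ i = vertex (quotient {t} r i) (remainder {t} r i)
  Φ-injective : ∀ i j → i ∈ ⊤ → j ∈ ⊤ → Φ i ≡ Φ j → i ≡ j
  Φ-injective i j _ _ eq with M-disjoint (enum-∈ (M _) _) (subst (_∈ M (quotient {t} r j)) (sym eq) (enum-∈ (M _) _))
  ... | q≡q = begin
    i                                                   ≡⟨ combine-remQuot {t} r i ⟨
    combine (quotient {t} r i) (remainder {t} r i)          ≡⟨ cong₂ combine q≡q
                                                           (vertex-injective (quotient {t} r j) (subst (λ q → vertex q _ ≡ _) q≡q eq)) ⟩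
    combine (quotient {t} r j) (remainder {t} r j)          ≡⟨ combine-remQuot {t} r j ⟩
    j                                                   ∎
    where open ≡-Reasoning
  Φ-edge : ∀ f → f ∈ₗ edges (Matching t r) → f ⊆ ⊤ → image Φ f ∈ₗ edges H
  Φ-edge f f∈ _ with ∈-Matching⁻ f∈
  ... | k , refl = subst (_∈ₗ edges H) (⊆-antisym M⊆ ⊆M) (M∈H k)
    where
    M⊆ : M k ⊆ image Φ (block t r k)
    M⊆ x∈M with enum-surjective (M k) x∈M
    ... | c , refl = subst (_∈ image Φ (block t r k)) Φi≡ (∈-image⁺ Φ _ (∈-block⁺ {t} {r} (cong proj₁ rq)))
      where
      i : Fin (t * r)
      i = combine k (cast (∣M∣≡r k) c)
      rq : remQuot {t} r i ≡ (k , cast (∣M∣≡r k) c)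
      rq = remQuot-combine k _
      Φi≡ : Φ i ≡ enum (M k) c
      Φi≡ = trans (cong₂ vertex (cong proj₁ rq) (cong proj₂ rq))
                  (cong (enum (M k)) (cast-involutive (sym (∣M∣≡r k)) (∣M∣≡r k) c))
    ⊆M : image Φ (block t r k) ⊆ M k
    ⊆M x∈ with ∈-image⁻ Φ _ x∈
    ... | i , i∈ , refl = subst (λ q → vertex q (remainder {t} r i) ∈ M k) (sym (∈-block⁻ {t} {r} i∈)) (enum-∈ (M k) _)

pairwiseDisjoint⇒Matching⊑ : ∀ t r (H : Hypergraph n) (L : List (Subset n)) → length L ≡ t →
  All (_∈ₗ edges H) L → All (λ e → ∣ e ∣ ≡ r) L → AllPairs Disjoint L → Matching t r ⊑ H
pairwiseDisjoint⇒Matching⊑ t r H L refl L⊆H ∣L∣≡r L-disjoint =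
  disjointEdges⇒Matching⊑ t r H (lookup L) (λ k → All.lookup L⊆H (∈-lookup k))
    (λ k → All.lookup ∣L∣≡r (∈-lookup k)) (lookup-disjoint L L-disjoint)
  where
  lookup-disjoint : ∀ L → AllPairs Disjoint L → ∀ {k l x} → x ∈ lookup L k → x ∈ lookup L l → k ≡ l
  lookup-disjoint (e ∷ L) (e#L ∷ _)  {zero}  {zero}  _ _ = refl
  lookup-disjoint (e ∷ L) (e#L ∷ _)  {zero}  {suc l} x∈e x∈ = contradiction x∈ (All.lookup e#L (∈-lookup l) x∈e)
  lookup-disjoint (e ∷ L) (e#L ∷ _)  {suc k} {zero}  x∈ x∈e = contradiction x∈ (All.lookup e#L (∈-lookup k) x∈e)
  lookup-disjoint (e ∷ L) (_ ∷ L#)   {suc k} {suc l} x∈ x∈′ = cong suc (lookup-disjoint L L# x∈ x∈′)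

-- Pigeonhole: two of the s + 1 disjoint edges would meet the cover in the same vertex.
coverable⇒¬Matching⊑ : ∀ {s} r (H : Hypergraph n) (c : Fin s → Fin n) →
  (∀ {g} → g ∈ₗ edges H → ∃[ a ] c a ∈ g) → ¬ (Matching (suc s) r ⊑ H)
coverable⇒¬Matching⊑ {s = s} r H c cover M⊑H with ⊑⇒embedding M⊑H
... | Φ , Φ-inj , Φ-edge = noCollision (pigeonhole (n<1+n s) hit)
  where
  hitAt : ∀ k → ∃[ a ] ∃[ i ] (i ∈ block (suc s) r k × Φ i ≡ c a)
  hitAt k with cover (Φ-edge (block (suc s) r k) (block∈Matching k) (λ _ → ∈⊤))
  ... | a , ca∈ = a , ∈-image⁻ Φ _ ca∈
  hit : Fin (suc s) → Fin s
  hit k = proj₁ (hitAt k)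
  hit-injective : ∀ {k l} → hit k ≡ hit l → k ≡ l
  hit-injective {k} {l} same =
    let (_ , i , i∈k , Φi≡) = hitAt k
        (_ , j , j∈l , Φj≡) = hitAt l
    in trans (sym (∈-block⁻ i∈k))
         (trans (cong (quotient r) (Φ-inj i j ∈⊤ ∈⊤ (trans Φi≡ (trans (cong c same) (sym Φj≡))))) (∈-block⁻ j∈l))
  noCollision : ¬ (∃₂ λ k l → k <ᶠ l × hit k ≡ hit l)
  noCollision (k , l , k<l , same) = Fin.<⇒≢ k<l (hit-injective same)

-- The lower bound construction

module _ {s k : ℕ} (x : Subset s) (y : Subset k) where

  ↑ˡ∈++⁺ : ∀ {a} → a ∈ x → (a ↑ˡ k) ∈ x ++ᵛ y
  ↑ˡ∈++⁺ {a} a∈x = Vec.lookup⇒[]= (a ↑ˡ k) (x ++ᵛ y) (trans (Vec.lookup-++ˡ x y a) (Vec.[]=⇒lookup a∈x))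

  ↑ˡ∈++⁻ : ∀ {a} → (a ↑ˡ k) ∈ x ++ᵛ y → a ∈ x
  ↑ˡ∈++⁻ {a} a∈ = Vec.lookup⇒[]= a x (trans (sym (Vec.lookup-++ˡ x y a)) (Vec.[]=⇒lookup a∈))

  ↑ʳ∈++⁺ : ∀ {b} → b ∈ y → (s ↑ʳ b) ∈ x ++ᵛ y
  ↑ʳ∈++⁺ {b} b∈y = Vec.lookup⇒[]= (s ↑ʳ b) (x ++ᵛ y) (trans (Vec.lookup-++ʳ x y b) (Vec.[]=⇒lookup b∈y))

∣x++y∣≡∣x∣+∣y∣ : ∀ {s k} (x : Subset s) (y : Subset k) → ∣ x ++ᵛ y ∣ ≡ ∣ x ∣ + ∣ y ∣
∣x++y∣≡∣x∣+∣y∣ []             y = refl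
∣x++y∣≡∣x∣+∣y∣ (inside  ∷ x)  y = cong suc (∣x++y∣≡∣x∣+∣y∣ x y)
∣x++y∣≡∣x∣+∣y∣ (outside ∷ x)  y = ∣x++y∣≡∣x∣+∣y∣ x y

↑ˡ⊎↑ʳ : ∀ s {k} (v : Fin (s + k)) → (∃[ a ] a ↑ˡ k ≡ v) ⊎ (∃[ b ] s ↑ʳ b ≡ v)
↑ˡ⊎↑ʳ s v with splitAt s v in eq
... | inj₁ a = inj₁ (a , splitAt⁻¹-↑ˡ eq)
... | inj₂ b = inj₂ (b , splitAt⁻¹-↑ʳ eq)

↑ˡ≢↑ʳ : ∀ s {k} (a : Fin s) (b : Fin k) → a ↑ˡ k ≢ s ↑ʳ b
↑ˡ≢↑ʳ s a b eq with trans (sym (splitAt-↑ˡ s a _)) (trans (cong (splitAt s) eq) (splitAt-↑ʳ s _ b))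
... | ()

-- S is the set of vertices of F sent outside [s]; it is weakly independent because every edge meets [s].
copy⇒deletionInCore : ∀ {s k} (F : Hypergraph m) (G : Hypergraph s) (H : Hypergraph (s + k)) →
  (∀ {z} → z ∈ₗ edges H → ∃[ a ] (a ↑ˡ k) ∈ z) →
  (∀ {z} → z ∈ₗ edges H → (∃[ b ] (s ↑ʳ b) ∈ z) ⊎ (∃[ g ] (g ∈ₗ edges G × z ≡ g ++ᵛ ⊥))) →
  F ⊑ H → ∃[ S ] (WeaklyIndependent F S × ContainsDeletion F S G)
copy⇒deletionInCore {m} {s} {k} F G H meetsCore inCoreOrMeetsRest F⊑H with ⊑⇒embedding F⊑H
... | Φ , Φ-inj , Φ-edge = S , S-wi , φ , φ-inj , φ-edge
  where
  outside? : Decidable (λ i → ∃[ b ] s ↑ʳ b ≡ Φ i)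
  outside? i = any? (λ b → s ↑ʳ b ≟ Φ i)
  S : Subset m
  S = subsetOf outside?
  inCore : ∀ i → i ∈ ∁ S → ∃[ a ] a ↑ˡ k ≡ Φ i
  inCore i i∈∁S with ↑ˡ⊎↑ʳ s (Φ i)
  ... | inj₁ core = core
  ... | inj₂ rest = contradiction (∈-subsetOf⁺ outside? rest) (x∈∁p⇒x∉p i∈∁S)
  S-wi : WeaklyIndependent F S
  S-wi f f∈F f⊆S with meetsCore (Φ-edge f f∈F (λ _ → ∈⊤))
  ... | a , a∈ with ∈-image⁻ Φ f a∈
  ... | i , i∈f , Φi≡a = let (b , b≡Φi) = ∈-subsetOf⁻ outside? (f⊆S i∈f) in ↑ˡ≢↑ʳ s a b (trans (sym Φi≡a) (sym b≡Φi))
  φ : Σ (Fin m) (_∈ ∁ S) → Fin s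
  φ (i , i∈∁S) = proj₁ (inCore i i∈∁S)
  φ-spec : ∀ x → φ x ↑ˡ k ≡ Φ (proj₁ x)
  φ-spec (i , i∈∁S) = proj₂ (inCore i i∈∁S)
  φ-inj : ∀ x y → φ x ≡ φ y → proj₁ x ≡ proj₁ y
  φ-inj x y eq = Φ-inj _ _ ∈⊤ ∈⊤ (trans (sym (φ-spec x)) (trans (cong (_↑ˡ k) eq) (φ-spec y)))
  φ-edge : ∀ f → f ∈ₗ edges F → f ⊆ ∁ S →
           ∃[ g ] (g ∈ₗ edges G × (∀ j → (j ∈ g) Function.Bundles.⇔ (∃[ x ] (proj₁ x ∈ f × φ x ≡ j))))
  φ-edge f f∈F f⊆∁S with inCoreOrMeetsRest (Φ-edge f f∈F (λ _ → ∈⊤))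
  ... | inj₁ (b , b∈) = let (i , i∈f , Φi≡b) = ∈-image⁻ Φ f b∈ in
                        contradiction (∈-subsetOf⁺ outside? (b , sym Φi≡b)) (x∈∁p⇒x∉p (f⊆∁S i∈f))
  ... | inj₂ (g , g∈G , Φf≡g) = g , g∈G , λ j → mk⇔ (to j) (from j)
    where
    to : ∀ j → j ∈ g → ∃[ x ] (proj₁ x ∈ f × φ x ≡ j)
    to j j∈g with ∈-image⁻ Φ f (subst ((j ↑ˡ k) ∈_) (sym Φf≡g) (↑ˡ∈++⁺ g ⊥ j∈g))
    ... | i , i∈f , Φi≡j = (i , f⊆∁S i∈f) , i∈f , ↑ˡ-injective k _ _ (trans (φ-spec (i , f⊆∁S i∈f)) Φi≡j)
    from : ∀ j → ∃[ x ] (proj₁ x ∈ f × φ x ≡ j) → j ∈ g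
    from j (x , i∈f , refl) = ↑ˡ∈++⁻ g ⊥ (subst ((φ x ↑ˡ k) ∈_) Φf≡g (subst (_∈ image Φ f) (sym (φ-spec x)) (∈-image⁺ Φ f i∈f)))

1≤i≤r∸1⇒i<r : ∀ {i r} → 1 ≤ i → i ≤ r ∸ 1 → i < r
1≤i≤r∸1⇒i<r {r = zero}  1≤i i≤0 = contradiction (≤-trans 1≤i i≤0) λ ()
1≤i≤r∸1⇒i<r {r = suc r} _   i≤r = s≤s i≤r

module Construction (r s k : ℕ) (1≤r : 1 ≤ r) (G : Hypergraph s) (G-rGraph : RGraph r G) where

  G-uniform : Uniform r G
  G-uniform = proj₁ G-rGraph

  G-unique : Unique (edges G)
  G-unique = proj₂ G-rGraph

  t : ℕ
  t = s ⊓ (r ∸ 1)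

  crossEdges : ℕ → List (Subset (s + k))
  crossEdges i = cartesianProductWith _++ᵛ_ (choose (⊤ {s}) i) (choose (⊤ {k}) (r ∸ i))

  crossEdgesUpTo : ℕ → List (Subset (s + k))
  crossEdgesUpTo zero    = []
  crossEdgesUpTo (suc i) = crossEdgesUpTo i ++ crossEdges (suc i)

  coreEdges : List (Subset (s + k))
  coreEdges = map (_++ᵛ ⊥) (edges G)

  H : Hypergraph (s + k)
  H = mkHypergraph (coreEdges ++ crossEdgesUpTo t)

  CrossEdge : ℕ → Subset (s + k) → Set
  CrossEdge j z = Σ[ x ∈ Subset s ] Σ[ y ∈ Subset k ] (z ≡ x ++ᵛ y × 1 ≤ ∣ x ∣ × ∣ x ∣ ≤ j × ∣ y ∣ ≡ r ∸ ∣ x ∣)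

  ∈-crossEdges⁻ : ∀ i {z} → z ∈ₗ crossEdges i → Σ[ x ∈ Subset s ] Σ[ y ∈ Subset k ] (z ≡ x ++ᵛ y × ∣ x ∣ ≡ i × ∣ y ∣ ≡ r ∸ i)
  ∈-crossEdges⁻ i z∈ with ∈-cartesianProductWith⁻ _++ᵛ_ (choose (⊤ {s}) i) (choose (⊤ {k}) (r ∸ i)) z∈
  ... | x , y , x∈ , y∈ , refl = x , y , refl , proj₂ (∈-choose⁻ ⊤ i x∈) , proj₂ (∈-choose⁻ ⊤ (r ∸ i) y∈)

  ∈-crossEdgesUpTo⁻ : ∀ j {z} → z ∈ₗ crossEdgesUpTo j → CrossEdge j z
  ∈-crossEdgesUpTo⁻ (suc j) z∈ with ∈-++⁻ (crossEdgesUpTo j) z∈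
  ... | inj₁ z∈′ = let (x , y , z≡ , 1≤ , ≤j , ∣y∣≡) = ∈-crossEdgesUpTo⁻ j z∈′ in x , y , z≡ , 1≤ , m≤n⇒m≤1+n ≤j , ∣y∣≡
  ... | inj₂ z∈′ = let (x , y , z≡ , ∣x∣≡ , ∣y∣≡) = ∈-crossEdges⁻ (suc j) z∈′ in
                   x , y , z≡ , ≤-trans (s≤s z≤n) (≤-reflexive (sym ∣x∣≡)) , ≤-reflexive ∣x∣≡ ,
                   trans ∣y∣≡ (cong (r ∸_) (sym ∣x∣≡))

  crossEdge-∣x∣<r : ∀ {z} → z ∈ₗ crossEdgesUpTo t → Σ[ x ∈ Subset s ] Σ[ y ∈ Subset k ] (z ≡ x ++ᵛ y × 1 ≤ ∣ x ∣ × ∣ x ∣ < r × ∣ y ∣ ≡ r ∸ ∣ x ∣)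
  crossEdge-∣x∣<r z∈ = let (x , y , z≡ , 1≤ , ≤t , ∣y∣≡) = ∈-crossEdgesUpTo⁻ t z∈ in
                       x , y , z≡ , 1≤ , 1≤i≤r∸1⇒i<r 1≤ (≤-trans ≤t (m⊓n≤n s (r ∸ 1))) , ∣y∣≡

  H-uniform : Uniform r H
  H-uniform = All.tabulate uniform
    where
    uniform : ∀ {z} → z ∈ₗ coreEdges ++ crossEdgesUpTo t → ∣ z ∣ ≡ r
    uniform z∈ with ∈-++⁻ coreEdges z∈
    ... | inj₁ z∈core = let (g , g∈G , z≡) = ∈-map⁻ (_++ᵛ ⊥) z∈core in
      trans (cong ∣_∣ z≡) (trans (∣x++y∣≡∣x∣+∣y∣ g ⊥) (trans (cong₂ _+_ (All.lookup G-uniform g∈G) (∣⊥∣≡0 k)) (+-identityʳ r)))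
    ... | inj₂ z∈cross = let (x , y , z≡ , _ , ∣x∣<r , ∣y∣≡) = crossEdge-∣x∣<r z∈cross in
      trans (cong ∣_∣ z≡) (trans (∣x++y∣≡∣x∣+∣y∣ x y) (trans (cong (∣ x ∣ +_) ∣y∣≡) (m+[n∸m]≡n (<⇒≤ ∣x∣<r))))

  ∣left∣ : ∀ (x x′ : Subset s) {y y′ : Subset k} → x ++ᵛ y ≡ x′ ++ᵛ y′ → ∣ x ∣ ≡ ∣ x′ ∣
  ∣left∣ x x′ eq = cong ∣_∣ (Vec.++-injectiveˡ x x′ eq)

  crossEdgesUpTo-Unique : ∀ j → Unique (crossEdgesUpTo j)
  crossEdgesUpTo-Unique zero    = []
  crossEdgesUpTo-Unique (suc j) = Unique.++⁺ (crossEdgesUpTo-Unique j)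
    (Unique.cartesianProductWith⁺ _++ᵛ_ (Vec.++-injective _ _)
      (choose-Unique (⊤ {s}) (suc j)) (choose-Unique (⊤ {k}) (r ∸ suc j)))
    λ (z∈ , z∈′) → let (x , y , z≡ , _ , ∣x∣≤j , _) = ∈-crossEdgesUpTo⁻ j z∈
                       (x′ , y′ , z≡′ , ∣x′∣≡ , _) = ∈-crossEdges⁻ (suc j) z∈′
                   in <⇒≢ (s≤s ∣x∣≤j) (trans (∣left∣ x x′ (trans (sym z≡) z≡′)) ∣x′∣≡)

  H-unique : Unique (edges H)
  H-unique = Unique.++⁺ (Unique.map⁺ (λ {g g′ : Subset s} → Vec.++-injectiveˡ g g′) G-unique) (crossEdgesUpTo-Unique t)
    λ (z∈core , z∈cross) → let (g , g∈G , z≡) = ∈-map⁻ (_++ᵛ ⊥) z∈core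
                               (x , y , z≡′ , _ , ∣x∣<r , _) = crossEdge-∣x∣<r z∈cross
                           in <⇒≢ ∣x∣<r (trans (∣left∣ x g (trans (sym z≡′) z≡)) (All.lookup G-uniform g∈G))

  length-crossEdgesUpTo : ∀ j → length (crossEdgesUpTo j) ≡ sum1 j (λ i → (s C i) * (k C (r ∸ i)))
  length-crossEdgesUpTo zero    = refl
  length-crossEdgesUpTo (suc j) = trans (length-++ (crossEdgesUpTo j)) (cong₂ _+_ (length-crossEdgesUpTo j) (begin
    length (crossEdges (suc j))
      ≡⟨ length-cartesianProductWith _++ᵛ_ (choose (⊤ {s}) (suc j)) (choose (⊤ {k}) (r ∸ suc j)) ⟩
    length (choose (⊤ {s}) (suc j)) * length (choose (⊤ {k}) (r ∸ suc j))
      ≡⟨ cong₂ _*_ (length-choose (⊤ {s}) (suc j)) (length-choose (⊤ {k}) (r ∸ suc j)) ⟩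
    (∣ ⊤ {s} ∣ C suc j) * (∣ ⊤ {k} ∣ C (r ∸ suc j))
      ≡⟨ cong₂ (λ a b → (a C suc j) * (b C (r ∸ suc j))) (∣⊤∣≡n s) (∣⊤∣≡n k) ⟩
    (s C suc j) * (k C (r ∸ suc j))
      ∎))
    where open ≡-Reasoning

  e-H : e H ≡ e G + sum1 t (λ i → (s C i) * (k C (r ∸ i)))
  e-H = trans (length-++ coreEdges) (cong₂ _+_ (length-map (_++ᵛ ⊥) (edges G)) (length-crossEdgesUpTo t))

  meetsCore : ∀ {z} → z ∈ₗ edges H → ∃[ a ] (a ↑ˡ k) ∈ z
  meetsCore z∈ with ∈-++⁻ coreEdges z∈
  ... | inj₁ z∈core = let (g , g∈G , z≡) = ∈-map⁻ (_++ᵛ ⊥) z∈core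
                          (a , a∈g) = 1≤∣p∣⇒Nonempty g (subst (1 ≤_) (sym (All.lookup G-uniform g∈G)) 1≤r)
                      in a , subst ((a ↑ˡ k) ∈_) (sym z≡) (↑ˡ∈++⁺ g ⊥ a∈g)
  ... | inj₂ z∈cross = let (x , y , z≡ , 1≤∣x∣ , _) = crossEdge-∣x∣<r z∈cross
                           (a , a∈x) = 1≤∣p∣⇒Nonempty x 1≤∣x∣
                       in a , subst ((a ↑ˡ k) ∈_) (sym z≡) (↑ˡ∈++⁺ x y a∈x)

  inCoreOrMeetsRest : ∀ {z} → z ∈ₗ edges H → (∃[ b ] (s ↑ʳ b) ∈ z) ⊎ (∃[ g ] (g ∈ₗ edges G × z ≡ g ++ᵛ ⊥))
  inCoreOrMeetsRest z∈ with ∈-++⁻ coreEdges z∈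
  ... | inj₁ z∈core = inj₂ (∈-map⁻ (_++ᵛ ⊥) z∈core)
  ... | inj₂ z∈cross = let (x , y , z≡ , _ , ∣x∣<r , ∣y∣≡) = crossEdge-∣x∣<r z∈cross
                           (b , b∈y) = 1≤∣p∣⇒Nonempty y (subst (1 ≤_) (sym ∣y∣≡) (m<n⇒0<n∸m ∣x∣<r))
                       in inj₁ (b , subst ((s ↑ʳ b) ∈_) (sym z≡) (↑ʳ∈++⁺ x y b∈y))

  H-¬Matching : ¬ (Matching (suc s) r ⊑ H)
  H-¬Matching = coverable⇒¬Matching⊑ r H (_↑ˡ k) meetsCore

  H-¬F : ∀ (F : Hypergraph m) → FreeOfDeletions F G → ¬ (F ⊑ H)
  H-¬F F G-free F⊑H = let (S , S-wi , F-S⊑G) = copy⇒deletionInCore F G H meetsCore inCoreOrMeetsRest F⊑H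
                      in G-free S S-wi F-S⊑G

lowerBound : ∀ r s n (F : Hypergraph m) {a} → 1 ≤ r → s ≤ n →
  ∃[ G ] (RGraph r {s} G × FreeOfDeletions F G × e G ≡ a) →
  ∃[ H ] (RGraph r {n} H × FreeOfFAndMatching r s F H × e H ≡ a + sum1 (s ⊓ (r ∸ 1)) (λ i → (s C i) * ((n ∸ s) C (r ∸ i))))
lowerBound r s n F {a} 1≤r s≤n (G , G-rGraph , G-free , refl) =
  subst Extremal (m+[n∸m]≡n s≤n) (H , (H-uniform , H-unique) , (H-¬F F G-free , H-¬Matching) , e-H)
  where
  open Construction r s (n ∸ s) 1≤r G G-rGraph
  Extremal : ℕ → Set
  Extremal n′ = ∃[ H ] (RGraph r {n′} H × FreeOfFAndMatching r s F H ×
                        e H ≡ e G + sum1 t (λ i → (s C i) * ((n ∸ s) C (r ∸ i))))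

-- Degrees, heavy vertices and greedy matchings

vertices : List (Subset n) → List (Fin n)
vertices []      = []
vertices (e ∷ L) = elements e ++ vertices L

∈-vertices⁺ : ∀ (L : List (Subset n)) {e x} → e ∈ₗ L → x ∈ e → x ∈ₗ vertices L
∈-vertices⁺ (e ∷ L) (here refl) x∈e = ∈-++⁺ˡ (∈-elements⁺ e x∈e)
∈-vertices⁺ (e ∷ L) (there e∈L) x∈e = ∈-++⁺ʳ (elements e) (∈-vertices⁺ L e∈L x∈e)

∈-vertices⁻ : ∀ (L : List (Subset n)) {x} → x ∈ₗ vertices L → ∃[ e ] (e ∈ₗ L × x ∈ e)
∈-vertices⁻ (e ∷ L) x∈ with ∈-++⁻ (elements e) x∈
... | inj₁ x∈e = e , here refl , ∈-elements⁻ e x∈e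
... | inj₂ x∈L = let (e′ , e′∈L , x∈e′) = ∈-vertices⁻ L x∈L in e′ , there e′∈L , x∈e′

length-vertices : ∀ {r} (L : List (Subset n)) → All (λ e → ∣ e ∣ ≡ r) L → length (vertices L) ≡ length L * r
length-vertices []      []            = refl
length-vertices (e ∷ L) (∣e∣≡r ∷ ∣L∣≡r) =
  trans (length-++ (elements e)) (cong₂ _+_ (trans (length-elements e) ∣e∣≡r) (length-vertices L ∣L∣≡r))

disjoint? : ∀ (p q : Subset n) → Dec (Disjoint p q)
disjoint? p q = map′ (λ h x∈p → h _ x∈p) (λ h x → h) (all? (λ x → (x ∈? p) →-dec ¬? (x ∈? q)))

¬Disjoint⇒Nonempty∩ : ∀ {p q : Subset n} → ¬ Disjoint p q → Nonempty (p ∩ q)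
¬Disjoint⇒Nonempty∩ {p = p} {q} ¬p#q with any? (λ x → (x ∈? p) ×-dec (x ∈? q))
... | yes (x , x∈p , x∈q) = x , x∈p∩q⁺ (x∈p , x∈q)
... | no  ¬∃              = ⊥-elim (¬p#q (λ {x} x∈p x∈q → ¬∃ (x , x∈p , x∈q)))

IsMatchingIn : Hypergraph n → List (Subset n) → Set
IsMatchingIn H L = All (_∈ₗ edges H) L × AllPairs Disjoint L

module GreedyMatching (H : Hypergraph n) (B : Subset n) where

  Avoids : List (Subset n) → Set
  Avoids M = IsMatchingIn H M × All (λ e → Disjoint e B) M

  addable? : ∀ e M → Dec (Disjoint e B × All (Disjoint e) M)
  addable? e M = disjoint? e B ×-dec All.all? (disjoint? e) M

  greedy : List (Subset n) → List (Subset n) → List (Subset n)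
  greedy []       M = M
  greedy (e ∷ es) M with addable? e M
  ... | yes _ = greedy es (e ∷ M)
  ... | no  _ = greedy es M

  greedy-avoids : ∀ es M → All (_∈ₗ edges H) es → Avoids M → Avoids (greedy es M)
  greedy-avoids []       M _            M-ok = M-ok
  greedy-avoids (e ∷ es) M (e∈H ∷ es⊆H) M-ok@((M⊆H , M-disj) , M#B) with addable? e M
  ... | yes (e#B , e#M) = greedy-avoids es (e ∷ M) es⊆H ((e∈H ∷ M⊆H , e#M ∷ M-disj) , e#B ∷ M#B)
  ... | no  _           = greedy-avoids es M es⊆H M-ok

  greedy-⊇ : ∀ es M {e} → e ∈ₗ M → e ∈ₗ greedy es M
  greedy-⊇ []        M e∈M = e∈M
  greedy-⊇ (e′ ∷ es) M e∈M with addable? e′ M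
  ... | yes _ = greedy-⊇ es (e′ ∷ M) (there e∈M)
  ... | no  _ = greedy-⊇ es M e∈M

  greedy-maximal : ∀ es M {e} → e ∈ₗ es → Nonempty e →
                   Nonempty (e ∩ B) ⊎ ∃[ e′ ] (e′ ∈ₗ greedy es M × Nonempty (e ∩ e′))
  greedy-maximal (e ∷ es) M (here refl) (x , x∈e) with addable? e M
  ... | yes _ = inj₂ (e , greedy-⊇ es (e ∷ M) (here refl) , x , x∈p∩q⁺ (x∈e , x∈e))
  ... | no ¬addable with disjoint? e B
  ...   | no  ¬e#B = inj₁ (¬Disjoint⇒Nonempty∩ ¬e#B)
  ...   | yes e#B  with find (All.¬All⇒Any¬ (disjoint? e) M (λ e#M → ¬addable (e#B , e#M)))
  ...     | e′ , e′∈M , ¬e#e′ = inj₂ (e′ , greedy-⊇ es M e′∈M , ¬Disjoint⇒Nonempty∩ ¬e#e′)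
  greedy-maximal (e′ ∷ es) M (there e∈es) ne with addable? e′ M
  ... | yes _ = greedy-maximal es (e′ ∷ M) e∈es ne
  ... | no  _ = greedy-maximal es M e∈es ne

-- Here and below r = 2 + q, so that r − 1 = 1 + q and r − 2 = q involve no truncated subtraction.
module Degrees (q : ℕ) (H : Hypergraph n) (H-rGraph : RGraph (2 + q) H) where

  H-uniform : Uniform (2 + q) H
  H-uniform = proj₁ H-rGraph

  H-unique : Unique (edges H)
  H-unique = proj₂ H-rGraph

  edgesAt : Fin n → List (Subset n)
  edgesAt v = filter (v ∈?_) (edges H)

  deg : Fin n → ℕ
  deg v = length (edgesAt v)

  ∈-edgesAt⁻ : ∀ v {e} → e ∈ₗ edgesAt v → e ∈ₗ edges H × v ∈ e
  ∈-edgesAt⁻ v = ∈-filter⁻ (v ∈?_) {xs = edges H}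

  private
    length-choose⊤ : ∀ k → length (choose (⊤ {n}) k) ≡ n C k
    length-choose⊤ k = trans (length-choose (⊤ {n}) k) (cong (_C k) (∣⊤∣≡n n))

  deg≤ : ∀ v → deg v ≤ n C (1 + q)
  deg≤ v = subst (deg v ≤_) (length-choose⊤ (1 + q))
    (injectiveOn⇒length≤ (_- v) (Unique.filter⁺ (v ∈?_) H-unique)
      (λ a∈ b∈ → -x-injective (proj₂ (∈-edgesAt⁻ v a∈)) (proj₂ (∈-edgesAt⁻ v b∈)))
      (λ {a} a∈ → let (a∈H , v∈a) = ∈-edgesAt⁻ v a∈ in
        ∈-choose⁺ ⊤ (1 + q) (λ _ → ∈⊤) (suc-injective (trans (∣p-x∣+1≡∣p∣ a v∈a) (All.lookup H-uniform a∈H)))))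

  codeg≤ : ∀ v x → x ≢ v → length (filter (x ∈?_) (edgesAt v)) ≤ n C q
  codeg≤ v x x≢v = subst (length edgesAtvx ≤_) (length-choose⊤ q)
    (injectiveOn⇒length≤ (λ a → a - v - x) (Unique.filter⁺ (x ∈?_) (Unique.filter⁺ (v ∈?_) H-unique))
      (λ a∈ b∈ eq → let (_ , v∈a , x∈a) = ∈-edgesAtvx a∈ ; (_ , v∈b , x∈b) = ∈-edgesAtvx b∈ in
        -x-injective v∈a v∈b (-x-injective (x∈p∧x≢y⇒x∈p-y x∈a x≢v) (x∈p∧x≢y⇒x∈p-y x∈b x≢v) eq))
      (λ {a} a∈ → let (a∈H , v∈a , x∈a) = ∈-edgesAtvx a∈ in
        ∈-choose⁺ ⊤ q (λ _ → ∈⊤) (suc-injective (suc-injective (begin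
          suc (suc ∣ a - v - x ∣) ≡⟨ cong suc (∣p-x∣+1≡∣p∣ (a - v) (x∈p∧x≢y⇒x∈p-y x∈a x≢v)) ⟩
          suc ∣ a - v ∣           ≡⟨ ∣p-x∣+1≡∣p∣ a v∈a ⟩
          ∣ a ∣                   ≡⟨ All.lookup H-uniform a∈H ⟩
          2 + q                   ∎)))))
    where
    open ≡-Reasoning
    edgesAtvx : List (Subset n)
    edgesAtvx = filter (x ∈?_) (edgesAt v)
    ∈-edgesAtvx : ∀ {a} → a ∈ₗ edgesAtvx → a ∈ₗ edges H × v ∈ a × x ∈ a
    ∈-edgesAtvx a∈ = let (a∈v , x∈a) = ∈-filter⁻ (x ∈?_) {xs = edgesAt v} a∈ ; (a∈H , v∈a) = ∈-edgesAt⁻ v a∈v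
                     in a∈H , v∈a , x∈a

  -- Otherwise every edge at v meets X, and each x ∈ X lies in at most C(n, q) of them.
  edgeAvoiding : ∀ v (X : List (Fin n)) → All (_≢ v) X → length X * (n C q) < deg v →
                 ∃[ e ] (e ∈ₗ edges H × v ∈ e × All (_∉ e) X)
  edgeAvoiding v X X∌v X-small with Any.any? (λ e → All.all? (λ x → ¬? (x ∈? e)) X) (edgesAt v)
  ... | yes ∃e = let (e , e∈ , X∉e) = find ∃e ; (e∈H , v∈e) = ∈-edgesAt⁻ v e∈ in e , e∈H , v∈e , X∉e
  ... | no  ∄e = contradiction X-small (≤⇒≯ (begin
    deg v                                             ≤⟨ length≤∑-count (λ x e → x ∈? e) (edgesAt v) X hit ⟩
    ∑ X (λ x → length (filter (x ∈?_) (edgesAt v)))   ≤⟨ ∑-mono X (λ x∈X → codeg≤ v _ (All.lookup X∌v x∈X)) ⟩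
    ∑ X (λ _ → n C q)                                 ≡⟨ ∑-const X (n C q) ⟩
    length X * (n C q)                                ∎))
    where
    open ≤-Reasoning
    hit : ∀ {e} → e ∈ₗ edgesAt v → ∃[ x ] (x ∈ₗ X × x ∈ e)
    hit {e} e∈ with Any.any? (_∈? e) X
    ... | yes ∃x = find ∃x
    ... | no  ∄x = ⊥-elim (∄e (lose e∈ (All.¬Any⇒All¬ X ∄x)))

module HeavyVertices (q s : ℕ) (H : Hypergraph n) (H-rGraph : RGraph (2 + q) H)
                  (H-¬Matching : ¬ (Matching (suc s) (2 + q) ⊑ H)) where

  open Degrees q H H-rGraph public

  r : ℕ
  r = 2 + q

  Heavy : Fin n → Set
  Heavy v = r * s * (n C q) < deg v

  B : Subset n
  B = subsetOf (λ v → r * s * (n C q) <? deg v)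

  ∣e∣≡r : ∀ {e} → e ∈ₗ edges H → ∣ e ∣ ≡ r
  ∣e∣≡r = All.lookup (proj₁ H-rGraph)

  matching≤s : ∀ {L} → IsMatchingIn H L → length L ≤ s
  matching≤s {L} (L⊆H , L-disjoint) with length L ≤? s
  ... | yes ≤s = ≤s
  ... | no  ≰s = contradiction
    (pairwiseDisjoint⇒Matching⊑ (suc s) r H (take (suc s) L) (trans (length-take (suc s) L) (m≤n⇒m⊓n≡m (≰⇒> ≰s)))
      (All.take⁺ (suc s) L⊆H) (All.take⁺ (suc s) (All.map ∣e∣≡r L⊆H)) (AllPairs.take⁺ (suc s) L-disjoint))
    H-¬Matching

  private
    avoidable : ∀ b bs L → All (_≢ b) bs → All (_∈ₗ edges H) L → All (b ∉_) L → Heavy b →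
                length bs + length L ≤ s → ∃[ e ] (e ∈ₗ edges H × All (Disjoint e) L × All (_∉ e) bs)
    avoidable b bs L bs∌b L⊆H b∉L b-heavy size
      with edgeAvoiding b (bs ++ vertices L) X∌b (≤-<-trans (*-monoˡ-≤ (n C q) ∣X∣≤rs) b-heavy)
      where
      X∌b : All (_≢ b) (bs ++ vertices L)
      X∌b = All.++⁺ bs∌b (All.tabulate λ x∈ x≡b →
              let (e , e∈L , x∈e) = ∈-vertices⁻ L x∈ in All.lookup b∉L e∈L (subst (_∈ e) x≡b x∈e))
      ∣X∣≤rs : length (bs ++ vertices L) ≤ r * s
      ∣X∣≤rs = begin
        length (bs ++ vertices L)       ≡⟨ length-++ bs ⟩
        length bs + length (vertices L)  ≡⟨ cong (length bs +_) (length-vertices L (All.map ∣e∣≡r L⊆H)) ⟩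
        length bs + length L * r         ≤⟨ +-monoˡ-≤ (length L * r) (m≤m*n (length bs) r) ⟩
        length bs * r + length L * r     ≡⟨ *-distribʳ-+ r (length bs) (length L) ⟨
        (length bs + length L) * r       ≤⟨ *-monoˡ-≤ r size ⟩
        s * r                            ≡⟨ *-comm s r ⟩
        r * s                            ∎
        where open ≤-Reasoning
    ... | e , e∈H , _ , X∉e =
      e , e∈H , All.tabulate (λ e′∈L x∈e x∈e′ → All.lookup X∉e (∈-++⁺ʳ bs (∈-vertices⁺ L e′∈L x∈e′)) x∈e) ,
      All.++⁻ˡ bs X∉e

  -- Each heavy vertex in turn still has an edge avoiding everything used so far.
  extend : ∀ bs L → Unique bs → All Heavy bs → IsMatchingIn H L → All (λ b → All (b ∉_) L) bs →
           length bs + length L ≤ suc s → Σ[ L′ ∈ List (Subset n) ] (IsMatchingIn H L′ × length L′ ≡ length bs + length L)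
  extend []       L _              _                  L-ok                 _               _    = L , L-ok , refl
  extend (b ∷ bs) L (bs∌b ∷ bs-u) (b-heavy ∷ bs-heavy) (L⊆H , L-disjoint) (b∉L ∷ bs∉L) size
    with avoidable b bs L (All.map (λ b≢ eq → b≢ (sym eq)) bs∌b) L⊆H b∉L b-heavy (s≤s⁻¹ size)
  ... | e , e∈H , e#L , bs∉e
    with extend bs (e ∷ L) bs-u bs-heavy (e∈H ∷ L⊆H , e#L ∷ L-disjoint)
                (All.zipWith (λ (b′∉e , b′∉L) → b′∉e ∷ b′∉L) (bs∉e , bs∉L)) (subst (_≤ suc s) (sym (+-suc (length bs) (length L))) size)
  ... | L′ , L′-ok , ∣L′∣≡ = L′ , L′-ok , trans ∣L′∣≡ (+-suc (length bs) (length L))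

  open GreedyMatching H B

  M : List (Subset n)
  M = greedy (edges H) []

  M-avoids : Avoids M
  M-avoids = greedy-avoids (edges H) [] (All.tabulate (λ e∈H → e∈H)) (([] , []) , [])

  B-heavy : ∀ {v} → v ∈ B → Heavy v
  B-heavy = ∈-subsetOf⁻ (λ v → r * s * (n C q) <? deg v)

  private
    noLargeMatching : ∀ bs L → Unique bs → All (_∈ B) bs → IsMatchingIn H L → All (λ b → All (b ∉_) L) bs →
                      length bs + length L ≢ suc s
    noLargeMatching bs L bs-u bs⊆B L-ok bs∉L size =
      let (L′ , L′-ok , ∣L′∣≡) = extend bs L bs-u (All.map B-heavy bs⊆B) L-ok bs∉L (≤-reflexive size)
      in <-irrefl refl (≤-trans (≤-reflexive (sym (trans ∣L′∣≡ size))) (matching≤s L′-ok))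

    elements-B⊆B : All (_∈ B) (elements B)
    elements-B⊆B = All.tabulate (∈-elements⁻ B)

  ∣B∣+∣M∣≤s : ∣ B ∣ + length M ≤ s
  ∣B∣+∣M∣≤s with ∣ B ∣ + length M ≤? s
  ... | yes ≤s = ≤s
  ... | no  ≰s with suc s ≤? ∣ B ∣
  ...   | yes s<∣B∣ = contradiction
    (trans (+-identityʳ _) (trans (length-take (suc s) (elements B))
      (trans (cong (suc s ⊓_) (length-elements B)) (m≤n⇒m⊓n≡m s<∣B∣))))
    (noLargeMatching (take (suc s) (elements B)) [] (Unique.take⁺ (suc s) (elements-Unique B))
      (All.take⁺ (suc s) elements-B⊆B) ([] , []) (All.tabulate (λ _ → [])))
  ...   | no  ∣B∣≤s = contradiction
    (begin-equality
      length (elements B) + length (take t M) ≡⟨ cong₂ _+_ (length-elements B) (length-take t M) ⟩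
      ∣ B ∣ + t ⊓ length M                    ≡⟨ cong (∣ B ∣ +_) (m≤n⇒m⊓n≡m t≤∣M∣) ⟩
      ∣ B ∣ + t                               ≡⟨ m+[n∸m]≡n (≰⇒≥ ∣B∣≤s) ⟩
      suc s                                   ∎)
    (noLargeMatching (elements B) (take t M) (elements-Unique B) elements-B⊆B
      (All.take⁺ t M⊆H , AllPairs.take⁺ t M-disjoint)
      (All.tabulate (λ b∈ → All.map (λ e#B b∈e → e#B b∈e (∈-elements⁻ B b∈)) (All.take⁺ t M#B))))
    where
    open ≤-Reasoning
    t = suc s ∸ ∣ B ∣
    M⊆H : All (_∈ₗ edges H) M
    M⊆H = proj₁ (proj₁ M-avoids)
    M-disjoint : AllPairs Disjoint M
    M-disjoint = proj₂ (proj₁ M-avoids)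
    M#B : All (λ e → Disjoint e B) M
    M#B = proj₂ M-avoids
    t≤∣M∣ : t ≤ length M
    t≤∣M∣ = ≤-trans (∸-monoˡ-≤ ∣ B ∣ (≰⇒> ≰s)) (≤-reflexive (m+n∸m≡n ∣ B ∣ (length M)))

  nonempty : ∀ {e} → e ∈ₗ edges H → Nonempty e
  nonempty e∈H = 1≤∣p∣⇒Nonempty _ (subst (1 ≤_) (sym (∣e∣≡r e∈H)) (s≤s z≤n))

  s≤∣B∣⇒covered : s ≤ ∣ B ∣ → ∣ B ∣ ≡ s × (∀ {e} → e ∈ₗ edges H → Nonempty (e ∩ B))
  s≤∣B∣⇒covered s≤∣B∣ = ≤-antisym (≤-trans (m≤m+n ∣ B ∣ (length M)) ∣B∣+∣M∣≤s) s≤∣B∣ , covered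
    where
    M≡[] : M ≡ []
    M≡[] = ≡[] M (n≤0⇒n≡0 (+-cancelˡ-≤ ∣ B ∣ (length M) 0
             (≤-trans ∣B∣+∣M∣≤s (≤-trans s≤∣B∣ (≤-reflexive (sym (+-identityʳ ∣ B ∣)))))))
      where
      ≡[] : ∀ (L : List (Subset n)) → length L ≡ 0 → L ≡ []
      ≡[] [] _ = refl
    covered : ∀ {e} → e ∈ₗ edges H → Nonempty (e ∩ B)
    covered e∈H with greedy-maximal (edges H) [] e∈H (nonempty e∈H)
    ... | inj₁ e∩B≠∅             = e∩B≠∅
    ... | inj₂ (e′ , e′∈M , _) = contradiction (subst (e′ ∈ₗ_) M≡[] e′∈M) λ ()

  -- Every edge meets B or the greedy matching M; vertices outside B have low degree.
  ∣B∣<s⇒fewEdges : ∣ B ∣ < s → e H ≤ (s ∸ 1) * (n C (1 + q)) + s * r * (r * s * (n C q))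
  ∣B∣<s⇒fewEdges ∣B∣<s = begin
    e H                                                   ≤⟨ length≤∑-count (λ x e → x ∈? e) (edges H) X hit ⟩
    ∑ X deg                                               ≡⟨ ∑-++ (elements B) (vertices M) deg ⟩
    ∑ (elements B) deg + ∑ (vertices M) deg               ≤⟨ +-mono-≤ (∑-mono (elements B) (λ {v} _ → deg≤ v))
                                                                       (∑-mono (vertices M) lowDegree) ⟩
    ∑ (elements B) (λ _ → n C (1 + q)) + ∑ (vertices M) (λ _ → r * s * (n C q))
                                                          ≡⟨ cong₂ _+_ (∑-const (elements B) _) (∑-const (vertices M) _) ⟩
    length (elements B) * (n C (1 + q)) + length (vertices M) * (r * s * (n C q))
                                                          ≤⟨ +-mono-≤ (*-monoˡ-≤ _ ∣B∣≤s-1) (*-monoˡ-≤ _ ∣V[M]∣≤sr) ⟩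
    (s ∸ 1) * (n C (1 + q)) + s * r * (r * s * (n C q))   ∎
    where
    open ≤-Reasoning
    X : List (Fin n)
    X = elements B ++ vertices M
    hit : ∀ {e} → e ∈ₗ edges H → ∃[ x ] (x ∈ₗ X × x ∈ e)
    hit e∈H with greedy-maximal (edges H) [] e∈H (nonempty e∈H)
    ... | inj₁ (x , x∈e∩B) = let (x∈e , x∈B) = x∈p∩q⁻ _ B x∈e∩B in x , ∈-++⁺ˡ (∈-elements⁺ B x∈B) , x∈e
    ... | inj₂ (e′ , e′∈M , x , x∈e∩e′) =
      let (x∈e , x∈e′) = x∈p∩q⁻ _ e′ x∈e∩e′ in x , ∈-++⁺ʳ (elements B) (∈-vertices⁺ M e′∈M x∈e′) , x∈e
    lowDegree : ∀ {x} → x ∈ₗ vertices M → deg x ≤ r * s * (n C q)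
    lowDegree x∈ = let (e′ , e′∈M , x∈e′) = ∈-vertices⁻ M x∈ in
      ≮⇒≥ (λ heavy → All.lookup (proj₂ M-avoids) e′∈M x∈e′ (∈-subsetOf⁺ (λ v → r * s * (n C q) <? deg v) heavy))
    ∣B∣≤s-1 : length (elements B) ≤ s ∸ 1
    ∣B∣≤s-1 = subst (_≤ s ∸ 1) (sym (length-elements B)) (∸-monoˡ-≤ 1 ∣B∣<s)
    ∣V[M]∣≤sr : length (vertices M) ≤ s * r
    ∣V[M]∣≤sr = begin
      length (vertices M) ≡⟨ length-vertices M (All.map ∣e∣≡r (proj₁ (proj₁ M-avoids))) ⟩
      length M * r        ≤⟨ *-monoˡ-≤ r (≤-trans (m≤n+m (length M) ∣ B ∣) ∣B∣+∣M∣≤s) ⟩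
      s * r               ∎

  dichotomy : (∣ B ∣ ≡ s × (∀ {e} → e ∈ₗ edges H → Nonempty (e ∩ B))) ⊎
              (e H ≤ (s ∸ 1) * (n C (1 + q)) + s * r * (r * s * (n C q)))
  dichotomy with ∣ B ∣ <? s
  ... | yes ∣B∣<s = inj₂ (∣B∣<s⇒fewEdges ∣B∣<s)
  ... | no  ∣B∣≮s = inj₁ (s≤∣B∣⇒covered (≮⇒≥ ∣B∣≮s))

-- Edges counted by their intersection with a vertex set

-- z ↦ (z ∩ B, z ∩ ∁B) is injective.
meeting≤C*C : ∀ (B : Subset n) r i (Z : List (Subset n)) → Unique Z →
              (∀ {z} → z ∈ₗ Z → ∣ z ∣ ≡ r × ∣ z ∩ B ∣ ≡ i) → length Z ≤ (∣ B ∣ C i) * ((n ∸ ∣ B ∣) C (r ∸ i))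
meeting≤C*C {n} B r i Z Z-unique Z-sizes = subst (length Z ≤_) length-pairs
  (injectiveOn⇒length≤ split Z-unique (λ _ _ eq → ⊆-antisym (⊆ eq) (⊆ (sym eq))) split∈pairs)
  where
  split : Subset n → Subset n × Subset n
  split z = z ∩ B , z ∩ ∁ B
  pairs : List (Subset n × Subset n)
  pairs = cartesianProduct (choose B i) (choose (∁ B) (r ∸ i))
  length-pairs : length pairs ≡ (∣ B ∣ C i) * ((n ∸ ∣ B ∣) C (r ∸ i))
  length-pairs = trans (length-cartesianProductWith _,_ (choose B i) (choose (∁ B) (r ∸ i)))
    (cong₂ _*_ (length-choose B i) (trans (length-choose (∁ B) (r ∸ i)) (cong (_C (r ∸ i)) (∣∁p∣≡n∸∣p∣ B))))
  ⊆ : ∀ {a b} → split a ≡ split b → a ⊆ b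
  ⊆ {a} {b} eq {x} x∈a with x ∈? B
  ... | yes x∈B = proj₁ (x∈p∩q⁻ b B (subst (x ∈_) (cong proj₁ eq) (x∈p∩q⁺ (x∈a , x∈B))))
  ... | no  x∉B = proj₁ (x∈p∩q⁻ b (∁ B) (subst (x ∈_) (cong proj₂ eq) (x∈p∩q⁺ (x∈a , x∉p⇒x∈∁p x∉B))))
  split∈pairs : ∀ {z} → z ∈ₗ Z → split z ∈ₗ pairs
  split∈pairs {z} z∈Z with Z-sizes z∈Z
  ... | ∣z∣≡r , ∣z∩B∣≡i = ∈-cartesianProduct⁺
    (∈-choose⁺ B i (p∩q⊆q z B) ∣z∩B∣≡i)
    (∈-choose⁺ (∁ B) (r ∸ i) (p∩q⊆q z (∁ B)) (begin
      ∣ z ∩ ∁ B ∣                          ≡⟨ m+n∸m≡n ∣ z ∩ B ∣ ∣ z ∩ ∁ B ∣ ⟨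
      ∣ z ∩ B ∣ + ∣ z ∩ ∁ B ∣ ∸ ∣ z ∩ B ∣  ≡⟨ cong₂ _∸_ (∣p∩q∣+∣p∩∁q∣≡∣p∣ z B) ∣z∩B∣≡i ⟩
      ∣ z ∣ ∸ i                            ≡⟨ cong (_∸ i) ∣z∣≡r ⟩
      r ∸ i                                ∎))
    where open ≡-Reasoning

induced : ∀ (B : Subset n) → Hypergraph n → Hypergraph ∣ B ∣
induced B H = mkHypergraph (map (restrict B) (filter (_⊆? B) (edges H)))

induced-rGraph : ∀ {r} (B : Subset n) (H : Hypergraph n) → RGraph r H → RGraph r (induced B H)
induced-rGraph B H (H-uniform , H-unique) =
  All.tabulate uniform ,
  Unique-map⁺ (restrict B) (λ e∈ f∈ → restrict-injective B (⊆B e∈) (⊆B f∈)) (Unique.filter⁺ (_⊆? B) H-unique)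
  where
  ⊆B : ∀ {e} → e ∈ₗ filter (_⊆? B) (edges H) → e ⊆ B
  ⊆B e∈ = proj₂ (∈-filter⁻ (_⊆? B) {xs = edges H} e∈)
  uniform : ∀ {e} → e ∈ₗ edges (induced B H) → ∣ e ∣ ≡ _
  uniform e∈ with ∈-map⁻ (restrict B) e∈
  ... | f , f∈ , refl = trans (∣restrict∣ B f (⊆B f∈)) (All.lookup H-uniform (proj₁ (∈-filter⁻ (_⊆? B) {xs = edges H} f∈)))

oneTo : ℕ → List ℕ
oneTo = applyUpTo suc

∑-oneTo : ∀ t (g : ℕ → ℕ) → ∑ (oneTo t) g ≡ sum1 t g
∑-oneTo zero    g = refl
∑-oneTo (suc t) g = begin
  ∑ (oneTo (suc t)) g           ≡⟨ cong (λ xs → ∑ xs g) (applyUpTo-∷ʳ suc t) ⟨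
  ∑ (oneTo t ∷ʳ suc t) g        ≡⟨ ∑-++ (oneTo t) (suc t ∷ []) g ⟩
  ∑ (oneTo t) g + (g (suc t) + 0) ≡⟨ cong₂ _+_ (∑-oneTo t g) (+-identityʳ (g (suc t))) ⟩
  sum1 t g + g (suc t)          ∎
  where open ≡-Reasoning

∈-oneTo⁺ : ∀ {t i} → 1 ≤ i → i ≤ t → i ∈ₗ oneTo t
∈-oneTo⁺ {t} {suc i} _ i<t = ∈-applyUpTo⁺ suc i<t

lookup-injective : ∀ {A : Set} (xs : List A) → Unique xs → ∀ {i j} → lookup xs i ≡ lookup xs j → i ≡ j
lookup-injective (x ∷ xs) (x∉xs ∷ u) {zero}  {zero}  _  = refl
lookup-injective (x ∷ xs) (x∉xs ∷ u) {zero}  {suc j} eq = contradiction eq (All.lookup x∉xs (∈-lookup j))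
lookup-injective (x ∷ xs) (x∉xs ∷ u) {suc i} {zero}  eq = contradiction (sym eq) (All.lookup x∉xs (∈-lookup i))
lookup-injective (x ∷ xs) (x∉xs ∷ u) {suc i} {suc j} eq = cong suc (lookup-injective xs u eq)

injectionInto : ∀ {A : Set} {m} (xs : List A) → Unique xs → m ≤ length xs →
                Σ[ ψ ∈ (Fin m → A) ] ((∀ {i j} → ψ i ≡ ψ j → i ≡ j) × (∀ i → ψ i ∈ₗ xs))
injectionInto xs xs-unique m≤ =
  (λ i → lookup xs (inject≤ i m≤)) ,
  (λ eq → inject≤-injective m≤ m≤ _ _ (lookup-injective xs xs-unique eq)) ,
  (λ i → ∈-lookup (inject≤ i m≤))

n≤∣outside∣+∣B∣+∣X∣ : ∀ (B : Subset n) (X : List (Fin n)) →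
           n ≤ length (filter (λ v → ¬? (v ∈? B) ×-dec ¬? (Any.any? (v ≟_) X)) (allFin n)) + (∣ B ∣ + length X)
n≤∣outside∣+∣B∣+∣X∣ {n} B X = begin
  n                                       ≡⟨ length-tabulate {n = n} (λ v → v) ⟨
  length (allFin n)                       ≤⟨ Unique∧⊆⇒length≤ (Unique.allFin⁺ n) covered ⟩
  length (Free ++ (elements B ++ X))    ≡⟨ length-++ Free ⟩
  length Free + length (elements B ++ X) ≡⟨ cong (length Free +_) (trans (length-++ (elements B)) (cong (_+ length X) (length-elements B))) ⟩
  length Free + (∣ B ∣ + length X)        ∎
  where
  open ≤-Reasoning
  free? : Decidable (λ v → v ∉ B × v ∉ₗ X)
  free? v = ¬? (v ∈? B) ×-dec ¬? (Any.any? (v ≟_) X)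
  Free : List (Fin n)
  Free = filter free? (allFin n)
  covered : ∀ {v} → v ∈ₗ allFin n → v ∈ₗ Free ++ (elements B ++ X)
  covered {v} v∈ with v ∈? B | Any.any? (v ≟_) X
  ... | yes v∈B | _       = ∈-++⁺ʳ Free (∈-++⁺ˡ (∈-elements⁺ B v∈B))
  ... | no  _   | yes v∈X = ∈-++⁺ʳ Free (∈-++⁺ʳ (elements B) v∈X)
  ... | no  v∉B | no  v∉X = ∈-++⁺ˡ (∈-filter⁺ free? v∈ (v∉B , v∉X))

Missing : ℕ → Hypergraph n → Subset n → Subset n → Set
Missing q H B z = z ∉ₗ edges H × ∣ z ∣ ≡ 2 + q × 1 ≤ ∣ z ∩ B ∣ × ∣ z ∩ B ∣ ≤ 1 + q

module MissingSets {m} (q : ℕ) (F : Hypergraph m) (F-uniform : Uniform (2 + q) F)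
                   (H : Hypergraph n) (H-¬F : ¬ (F ⊑ H))
                   (B : Subset n) (S : Subset m) (S-wi : WeaklyIndependent F S)
                   (Φ₀ : Fin m → Fin ∣ B ∣) (Φ₀-embedding : IsEmbeddingOn F (∁ S) (induced B H) Φ₀) where

  Φ₀-injective : ∀ i j → i ∈ ∁ S → j ∈ ∁ S → Φ₀ i ≡ Φ₀ j → i ≡ j
  Φ₀-injective = proj₁ Φ₀-embedding

  Φ₀-edge : ∀ f → f ∈ₗ edges F → f ⊆ ∁ S → image Φ₀ f ∈ₗ edges (induced B H)
  Φ₀-edge = proj₂ Φ₀-embedding

  module Extension (ψ : Fin m → Fin n) (ψ-injective : ∀ {i j} → ψ i ≡ ψ j → i ≡ j) (ψ∉B : ∀ i → ψ i ∉ B) where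

    Φ : Fin m → Fin n
    Φ i with i ∈? S
    ... | yes _ = ψ i
    ... | no  _ = enum B (Φ₀ i)

    Φ-∈S : ∀ {i} → i ∈ S → Φ i ≡ ψ i
    Φ-∈S {i} i∈S with i ∈? S
    ... | yes _   = refl
    ... | no  i∉S = contradiction i∈S i∉S

    Φ-∉S : ∀ {i} → i ∉ S → Φ i ≡ enum B (Φ₀ i)
    Φ-∉S {i} i∉S with i ∈? S
    ... | yes i∈S = contradiction i∈S i∉S
    ... | no  _   = refl

    Φ-injective : ∀ {i j} → Φ i ≡ Φ j → i ≡ j
    Φ-injective {i} {j} eq with i ∈? S | j ∈? S
    ... | yes _   | yes _   = ψ-injective eq
    ... | no  i∉S | no  j∉S = Φ₀-injective i j (x∉p⇒x∈∁p i∉S) (x∉p⇒x∈∁p j∉S) (enum-injective B eq)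
    ... | yes _   | no  _   = contradiction (subst (_∈ B) (sym eq) (enum-∈ B _)) (ψ∉B i)
    ... | no  _   | yes _   = contradiction (subst (_∈ B) eq (enum-∈ B _)) (ψ∉B j)

    image∈H : ∀ f → f ∈ₗ edges F → f ⊆ ∁ S → image Φ f ∈ₗ edges H
    image∈H f f∈F f⊆∁S with ∈-map⁻ (restrict B) (Φ₀-edge f f∈F f⊆∁S)
    ... | g , g∈ , Φ₀f≡ with ∈-filter⁻ (_⊆? B) {xs = edges H} g∈
    ... | g∈H , g⊆B = subst (_∈ₗ edges H) (⊆-antisym g⊆ ⊆g) g∈H
      where
      g⊆ : g ⊆ image Φ f
      g⊆ x∈g with enum-surjective B (g⊆B x∈g)
      ... | k , refl with ∈-image⁻ Φ₀ f (subst (k ∈_) (sym Φ₀f≡) (restrict-∈⁺ B g x∈g))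
      ... | i , i∈f , refl = subst (_∈ image Φ f) (Φ-∉S (x∈∁p⇒x∉p (f⊆∁S i∈f))) (∈-image⁺ Φ f i∈f)
      ⊆g : image Φ f ⊆ g
      ⊆g x∈ with ∈-image⁻ Φ f x∈
      ... | i , i∈f , refl = subst (_∈ g) (sym (Φ-∉S (x∈∁p⇒x∉p (f⊆∁S i∈f))))
                               (restrict-∈⁻ B g (subst (Φ₀ i ∈_) Φ₀f≡ (∈-image⁺ Φ₀ f i∈f)))

    -- The missing image meets S (else it would be an edge of the copy in B) and ∁S (S is weakly independent).
    missingImage : ∃[ f ] (Missing q H B (image Φ f) × ∃[ i ] (i ∈ S × Φ i ∈ image Φ f))
    missingImage with All.all? (λ f → image Φ f ∈ₗ? edges H) (edges F)
    ... | yes all∈H = ⊥-elim (H-¬F (embeddingOn⇒containsOn F ⊤ H ((λ i j _ _ → Φ-injective) , λ f f∈F _ → All.lookup all∈H f∈F)))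
    ... | no  ¬all∈H with find (All.¬All⇒Any¬ (λ f → image Φ f ∈ₗ? edges H) (edges F) ¬all∈H)
    ... | f , f∈F , Φf∉H with f ⊆? ∁ S
    ...   | yes f⊆∁S = ⊥-elim (Φf∉H (image∈H f f∈F f⊆∁S))
    ...   | no  f⊈∁S with ¬⊆⇒∃∉ f⊈∁S | ¬⊆⇒∃∉ (S-wi f f∈F)
    ... | i , i∈f , i∉∁S | j , j∈f , j∉S =
      f , (Φf∉H , ∣z∣≡r , 1≤∣z∩B∣ , ∣z∩B∣≤1+q) , i , x∉∁p⇒x∈p i∉∁S , ∈-image⁺ Φ f i∈f
      where
      open ≤-Reasoning
      z : Subset n
      z = image Φ f
      ∣z∣≡r : ∣ z ∣ ≡ 2 + q
      ∣z∣≡r = trans (∣image∣ Φ f Φ-injective) (All.lookup F-uniform f∈F)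
      1≤∣z∩B∣ : 1 ≤ ∣ z ∩ B ∣
      1≤∣z∩B∣ = x∈p⇒1≤∣p∣ (x∈p∩q⁺ (∈-image⁺ Φ f j∈f , subst (_∈ B) (sym (Φ-∉S j∉S)) (enum-∈ B _)))
      ∣z∩B∣≤1+q : ∣ z ∩ B ∣ ≤ 1 + q
      ∣z∩B∣≤1+q = s≤s⁻¹ (begin
        suc ∣ z ∩ B ∣           ≡⟨ +-comm 1 ∣ z ∩ B ∣ ⟩
        ∣ z ∩ B ∣ + 1           ≤⟨ +-monoʳ-≤ ∣ z ∩ B ∣ (x∈p⇒1≤∣p∣ (x∈p∩q⁺ (∈-image⁺ Φ f i∈f ,
                                     subst (_∈ ∁ B) (sym (Φ-∈S (x∉∁p⇒x∈p i∉∁S))) (x∉p⇒x∈∁p (ψ∉B i))))) ⟩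
        ∣ z ∩ B ∣ + ∣ z ∩ ∁ B ∣ ≡⟨ ∣p∩q∣+∣p∩∁q∣≡∣p∣ z B ⟩
        ∣ z ∣                   ≡⟨ ∣z∣≡r ⟩
        2 + q                   ∎)

  missingAvoiding : ∀ (Used : List (Subset n)) → All (λ z → ∣ z ∣ ≡ 2 + q) Used →
                    m + ∣ B ∣ + length Used * (2 + q) ≤ n → ∃[ z ] (Missing q H B z × z ∉ₗ Used)
  missingAvoiding Used Used-sizes room =
    let (ψ , ψ-injective , ψ∈Free) = injectionInto Free (Unique.filter⁺ free? (Unique.allFin⁺ n)) m≤∣Free∣
    in missingAvoidingVia ψ ψ-injective (λ i → proj₂ (∈-filter⁻ free? {xs = allFin n} (ψ∈Free i)))
    where
    X : List (Fin n)
    X = vertices Used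
    free? : Decidable (λ v → v ∉ B × v ∉ₗ X)
    free? v = ¬? (v ∈? B) ×-dec ¬? (Any.any? (v ≟_) X)
    Free : List (Fin n)
    Free = filter free? (allFin n)
    m≤∣Free∣ : m ≤ length Free
    m≤∣Free∣ = +-cancelʳ-≤ (∣ B ∣ + length X) m (length Free) (begin
      m + (∣ B ∣ + length X)              ≡⟨ cong (λ l → m + (∣ B ∣ + l)) (length-vertices Used Used-sizes) ⟩
      m + (∣ B ∣ + length Used * (2 + q)) ≡⟨ +-assoc m ∣ B ∣ _ ⟨
      m + ∣ B ∣ + length Used * (2 + q)   ≤⟨ room ⟩
      n                                   ≤⟨ n≤∣outside∣+∣B∣+∣X∣ B X ⟩
      length Free + (∣ B ∣ + length X)    ∎)
      where open ≤-Reasoning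
    missingAvoidingVia : ∀ (ψ : Fin m → Fin n) → (∀ {i j} → ψ i ≡ ψ j → i ≡ j) → (∀ i → ψ i ∉ B × ψ i ∉ₗ X) →
                         ∃[ z ] (Missing q H B z × z ∉ₗ Used)
    missingAvoidingVia ψ ψ-injective ψ-free =
      let (f , f-missing , i , i∈S , Φi∈) = missingImage in
      image Φ f , f-missing , λ Φf∈Used → proj₂ (ψ-free i) (∈-vertices⁺ Used Φf∈Used (subst (_∈ image Φ f) (Φ-∈S i∈S) Φi∈))
      where open Extension ψ ψ-injective (λ i → proj₁ (ψ-free i))

  missingList : ∀ k → m + ∣ B ∣ + k * (2 + q) ≤ n →
                Σ[ Ms ∈ List (Subset n) ] (length Ms ≡ k × Unique Ms × All (Missing q H B) Ms)
  missingList zero    _    = [] , refl , [] , []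
  missingList (suc k) room =
    let (Ms , ∣Ms∣≡k , Ms-unique , Ms-missing) = missingList k (≤-trans (+-monoʳ-≤ (m + ∣ B ∣) (*-monoˡ-≤ (2 + q) (n≤1+n k))) room)
        (z , z-missing , z∉Ms) = missingAvoiding Ms (All.map (λ z-missing → proj₁ (proj₂ z-missing)) Ms-missing)
          (≤-trans (+-monoʳ-≤ (m + ∣ B ∣) (*-monoˡ-≤ (2 + q) (≤-trans (≤-reflexive ∣Ms∣≡k) (n≤1+n k)))) room)
    in z ∷ Ms , cong suc ∣Ms∣≡k , All.tabulate (λ z′∈ z≡z′ → z∉Ms (subst (_∈ₗ Ms) (sym z≡z′) z′∈)) ∷ Ms-unique ,
       z-missing ∷ Ms-missing

module CoveredBound {m} (q : ℕ) (F : Hypergraph m) (F-uniform : Uniform (2 + q) F)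
                    (H : Hypergraph n) (H-rGraph : RGraph (2 + q) H) (H-¬F : ¬ (F ⊑ H))
                    (B : Subset n) (covered : ∀ {e} → e ∈ₗ edges H → Nonempty (e ∩ B)) where

  r : ℕ
  r = 2 + q

  g : ℕ → ℕ
  g i = (∣ B ∣ C i) * ((n ∸ ∣ B ∣) C (r ∸ i))

  layer? : ∀ i z → Dec (∣ z ∩ B ∣ ≡ i)
  layer? i z = ∣ z ∩ B ∣ Data.Nat.≟ i

  count : List (Subset n) → ℕ → ℕ
  count Z i = length (filter (layer? i) Z)

  count≤g : ∀ Z → Unique Z → All (λ z → ∣ z ∣ ≡ r) Z → ∀ i → count Z i ≤ g i
  count≤g Z Z-unique Z-sizes i = meeting≤C*C B r i (filter (layer? i) Z) (Unique.filter⁺ (layer? i) Z-unique)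
    (λ z∈ → let (z∈Z , ∣z∩B∣≡i) = ∈-filter⁻ (layer? i) {xs = Z} z∈ in All.lookup Z-sizes z∈Z , ∣z∩B∣≡i)

  E : List (Subset n)
  E = edges H

  e≤layers : e H ≤ ∑ (oneTo (1 + q)) (count E) + count E r
  e≤layers = begin
    e H                                               ≤⟨ length≤∑-count layer? E (oneTo r) inLayer ⟩
    ∑ (oneTo r) (count E)                             ≡⟨ cong (λ l → ∑ l (count E)) (applyUpTo-∷ʳ suc (1 + q)) ⟨
    ∑ (oneTo (1 + q) ∷ʳ r) (count E)                  ≡⟨ ∑-++ (oneTo (1 + q)) (r ∷ []) (count E) ⟩
    ∑ (oneTo (1 + q)) (count E) + (count E r + 0)     ≡⟨ cong (∑ (oneTo (1 + q)) (count E) +_) (+-identityʳ _) ⟩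
    ∑ (oneTo (1 + q)) (count E) + count E r           ∎
    where
    open ≤-Reasoning
    inLayer : ∀ {e} → e ∈ₗ E → ∃[ i ] (i ∈ₗ oneTo r × ∣ e ∩ B ∣ ≡ i)
    inLayer {e} e∈H = ∣ e ∩ B ∣ , ∈-oneTo⁺ (let (x , x∈) = covered e∈H in x∈p⇒1≤∣p∣ x∈)
      (≤-trans (∣p∩q∣≤∣p∣ e B) (≤-reflexive (All.lookup (proj₁ H-rGraph) e∈H))) , refl

  topLayer≤induced : count E r ≤ e (induced B H)
  topLayer≤induced = begin
    count E r                                ≤⟨ Unique∧⊆⇒length≤ (Unique.filter⁺ (layer? r) (proj₂ H-rGraph)) ⊆inside ⟩
    length (filter (_⊆? B) E)                ≡⟨ length-map (restrict B) (filter (_⊆? B) E) ⟨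
    e (induced B H)                          ∎
    where
    open ≤-Reasoning
    ⊆inside : ∀ {z} → z ∈ₗ filter (layer? r) E → z ∈ₗ filter (_⊆? B) E
    ⊆inside {z} z∈ = let (z∈H , ∣z∩B∣≡r) = ∈-filter⁻ (layer? r) {xs = E} z∈ in
      ∈-filter⁺ (_⊆? B) z∈H (∣p∩q∣≡∣p∣⇒p⊆q z B (trans ∣z∩B∣≡r (sym (All.lookup (proj₁ H-rGraph) z∈H))))

  lowLayers≤ : ∑ (oneTo (1 + q)) (count E) ≤ sum1 (1 + q) g
  lowLayers≤ = ≤-trans (∑-mono (oneTo (1 + q)) (λ {i} _ → count≤g E (proj₂ H-rGraph) (proj₁ H-rGraph) i))
                       (≤-reflexive (∑-oneTo (1 + q) g))

  boundFree : ∀ {a} → IsEx r ∣ B ∣ (FreeOfDeletions F) a → FreeOfDeletions F (induced B H) → e H ≤ a + sum1 (1 + q) g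
  boundFree {a} isEx free = begin
    e H                                          ≤⟨ e≤layers ⟩
    ∑ (oneTo (1 + q)) (count E) + count E r      ≤⟨ +-mono-≤ lowLayers≤ (≤-trans topLayer≤induced
                                                      (proj₂ isEx (induced B H) (induced-rGraph B H H-rGraph) free)) ⟩
    sum1 (1 + q) g + a                           ≡⟨ +-comm (sum1 (1 + q) g) a ⟩
    a + sum1 (1 + q) g                           ∎
    where open ≤-Reasoning

  -- Each of the C(∣B∣, r) missing r-sets takes a slot in a low layer, which pays for the edges inside B.
  boundMissing : ∀ Ms → length Ms ≡ ∣ B ∣ C r → Unique Ms → All (Missing q H B) Ms → e H ≤ sum1 (1 + q) g
  boundMissing Ms ∣Ms∣≡K Ms-unique Ms-missing = begin
    e H                                                     ≤⟨ e≤layers ⟩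
    ∑ low (count E) + count E r                             ≤⟨ +-monoʳ-≤ (∑ low (count E)) (≤-trans topLayer≤K (≤-reflexive (sym ∣Ms∣≡K))) ⟩
    ∑ low (count E) + length Ms                             ≤⟨ +-monoʳ-≤ (∑ low (count E)) (length≤∑-count layer? Ms low inLowLayer) ⟩
    ∑ low (count E) + ∑ low (count Ms)                      ≡⟨ ∑-+ low (count E) (count Ms) ⟨
    ∑ low (λ i → count E i + count Ms i)                    ≤⟨ ∑-mono low (λ {i} _ → both≤g i) ⟩
    ∑ low g                                                 ≡⟨ ∑-oneTo (1 + q) g ⟩
    sum1 (1 + q) g                                          ∎
    where
    open ≤-Reasoning
    low : List ℕ
    low = oneTo (1 + q)
    K : ℕ
    K = ∣ B ∣ C r
    topLayer≤K : count E r ≤ K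
    topLayer≤K = ≤-trans (count≤g E (proj₂ H-rGraph) (proj₁ H-rGraph) r) (≤-reflexive (begin-equality
      K * ((n ∸ ∣ B ∣) C (r ∸ r))  ≡⟨ cong (λ j → K * ((n ∸ ∣ B ∣) C j)) (n∸n≡0 r) ⟩
      K * ((n ∸ ∣ B ∣) C 0)        ≡⟨ cong (K *_) (nC0≡1 (n ∸ ∣ B ∣)) ⟩
      K * 1                        ≡⟨ *-identityʳ K ⟩
      K                            ∎))
    inLowLayer : ∀ {z} → z ∈ₗ Ms → ∃[ i ] (i ∈ₗ low × ∣ z ∩ B ∣ ≡ i)
    inLowLayer {z} z∈ = let (_ , _ , 1≤ , ≤1+q) = All.lookup Ms-missing z∈ in ∣ z ∩ B ∣ , ∈-oneTo⁺ 1≤ ≤1+q , refl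
    E++Ms-unique : Unique (E ++ Ms)
    E++Ms-unique = Unique.++⁺ (proj₂ H-rGraph) Ms-unique (λ (z∈E , z∈Ms) → proj₁ (All.lookup Ms-missing z∈Ms) z∈E)
    both≤g : ∀ i → count E i + count Ms i ≤ g i
    both≤g i = begin
      count E i + count Ms i   ≡⟨ trans (cong length (filter-++ (layer? i) E Ms)) (length-++ (filter (layer? i) E)) ⟨
      count (E ++ Ms) i       ≤⟨ count≤g (E ++ Ms) E++Ms-unique
                                    (All.++⁺ (proj₁ H-rGraph) (All.map (λ z-missing → proj₁ (proj₂ z-missing)) Ms-missing)) i ⟩
      g i                      ∎

  bound : ∀ {a} → IsEx r ∣ B ∣ (FreeOfDeletions F) a → m + ∣ B ∣ + (∣ B ∣ C r) * r ≤ n → Fin ∣ B ∣ →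
          e H ≤ a + sum1 (1 + q) g
  bound {a} isEx room default with deletion? F (induced B H) default
  ... | no  ¬deletion          = boundFree isEx (λ S S-wi c → ¬deletion (S , S-wi , c))
  ... | yes (S , S-wi , F-S⊑) =
    let (Φ₀ , Φ₀-embedding) = containsOn⇒embeddingOn F (∁ S) (induced B H) default F-S⊑
        (Ms , ∣Ms∣≡K , Ms-unique , Ms-missing) =
          MissingSets.missingList q F F-uniform H H-¬F B S S-wi Φ₀ Φ₀-embedding (∣ B ∣ C r) room
    in ≤-trans (boundMissing Ms ∣Ms∣≡K Ms-unique Ms-missing) (m≤n+m _ a)

-- The upper bound

sum1-vanishing : ∀ s d (g : ℕ → ℕ) → (∀ i → s < i → g i ≡ 0) → sum1 (s + d) g ≡ sum1 s g
sum1-vanishing s zero    g g≡0 = cong (λ t → sum1 t g) (+-identityʳ s)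
sum1-vanishing s (suc d) g g≡0 = begin
  sum1 (s + suc d) g             ≡⟨ cong (λ t → sum1 t g) (+-suc s d) ⟩
  sum1 (s + d) g + g (suc (s + d)) ≡⟨ cong₂ _+_ (sum1-vanishing s d g g≡0) (g≡0 _ (s≤s (m≤m+n s d))) ⟩
  sum1 s g + 0                   ≡⟨ +-identityʳ _ ⟩
  sum1 s g                       ∎
  where open ≡-Reasoning

sum1-⊓ : ∀ s t (g : ℕ → ℕ) → (∀ i → s < i → g i ≡ 0) → sum1 t g ≡ sum1 (s ⊓ t) g
sum1-⊓ s t g g≡0 with ≤-total s t
... | inj₁ s≤t = begin
  sum1 t g             ≡⟨ cong (λ u → sum1 u g) (m+[n∸m]≡n s≤t) ⟨
  sum1 (s + (t ∸ s)) g ≡⟨ sum1-vanishing s (t ∸ s) g g≡0 ⟩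
  sum1 s g             ≡⟨ cong (λ u → sum1 u g) (m≤n⇒m⊓n≡m s≤t) ⟨
  sum1 (s ⊓ t) g       ∎
  where open ≡-Reasoning
... | inj₂ t≤s = cong (λ u → sum1 u g) (sym (m≥n⇒m⊓n≡n t≤s))

g1≤sum1 : ∀ t (g : ℕ → ℕ) → 1 ≤ t → g 1 ≤ sum1 t g
g1≤sum1 (suc zero)    g _ = ≤-refl
g1≤sum1 (suc (suc t)) g _ = ≤-trans (g1≤sum1 (suc t) g (s≤s z≤n)) (m≤m+n _ _)

-- For m large, K C(s + m, q) ≤ C(m, q + 1): the bound when there are few heavy vertices is of lower order
-- than the i = 1 term s C(m, q + 1).
fewEdges≤ : ∀ q s′ m → let s = suc s′ ; r = 2 + q ; K = s′ * s + s * r * (r * s) in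
            2 * q + suc q * (K * 2 ^ s) ≤ m →
            s′ * ((s + m) C suc q) + s * r * (r * s * ((s + m) C q)) ≤ s * (m C suc q)
fewEdges≤ q s′ m big = begin
  s′ * ((s + m) C suc q) + s * r * (r * s * Y)        ≤⟨ +-monoˡ-≤ _ (*-monoʳ-≤ s′ ([d+n]C[k+1]≤nC[k+1]+d*[d+n]Ck s m q)) ⟩
  s′ * (X + s * Y) + s * r * (r * s * Y)              ≡⟨ solve 5 (λ s′ X s Y r → s′ :* (X :+ s :* Y) :+ s :* r :* (r :* s :* Y)
                                                               := s′ :* X :+ (s′ :* s :+ s :* r :* (r :* s)) :* Y) refl s′ X s Y r ⟩
  s′ * X + K * Y                                      ≤⟨ +-monoʳ-≤ (s′ * X) (c*[d+n]Ck≤nC[k+1] K s m q big) ⟩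
  s′ * X + X                                          ≡⟨ +-comm (s′ * X) X ⟩
  s * X                                               ∎
  where
  open ≤-Reasoning
  s r K : ℕ
  s = suc s′
  r = 2 + q
  K = s′ * s + s * r * (r * s)
  X Y : ℕ
  X = m C suc q
  Y = (s + m) C q

module UpperBound {m} (q s′ : ℕ) (F : Hypergraph m) (F-uniform : Uniform (2 + q) F)
                  {a} (isEx : IsEx (2 + q) (suc s′) (FreeOfDeletions F) a) where

  s r K roomForMissing roomForAsymptotics n₀ : ℕ
  s = suc s′
  r = 2 + q
  K = s′ * s + s * r * (r * s)
  roomForMissing = m + s + (s C r) * r
  roomForAsymptotics = 2 * q + suc q * (K * 2 ^ s)
  n₀ = s + (roomForMissing + roomForAsymptotics)

  g : ℕ → ℕ → ℕ
  g n i = (s C i) * ((n ∸ s) C (r ∸ i))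

  sum1-g : ∀ n → sum1 (1 + q) (g n) ≡ sum1 (s ⊓ (r ∸ 1)) (g n)
  sum1-g n = sum1-⊓ s (1 + q) (g n) (λ i s<i → cong (_* ((n ∸ s) C (r ∸ i))) (k>n⇒nCk≡0 s<i))

  coveredCase : ∀ n → n₀ ≤ n → ∀ (H : Hypergraph n) → RGraph r H → ¬ (F ⊑ H) → ∀ (B : Subset n) →
                ∣ B ∣ ≡ s → (∀ {e} → e ∈ₗ edges H → Nonempty (e ∩ B)) →
                e H ≤ a + sum1 (s ⊓ (r ∸ 1)) (g n)
  coveredCase n n₀≤n H H-rGraph H-¬F B ∣B∣≡s covered = subst (e H ≤_) (cong (a +_) sum1≡)
    (CoveredBound.bound q F F-uniform H H-rGraph H-¬F B covered
      (subst (λ b → IsEx r b (FreeOfDeletions F) a) (sym ∣B∣≡s) isEx)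
      (subst (λ b → m + b + (b C r) * r ≤ n) (sym ∣B∣≡s) (≤-trans (m≤m+n roomForMissing roomForAsymptotics) (≤-trans (m≤n+m _ s) n₀≤n)))
      default)
    where
    default : Fin ∣ B ∣
    default = let (x , x∈B) = 1≤∣p∣⇒Nonempty B (subst (1 ≤_) (sym ∣B∣≡s) (s≤s z≤n)) in proj₁ (enum-surjective B x∈B)
    sum1≡ : sum1 (1 + q) (λ i → (∣ B ∣ C i) * ((n ∸ ∣ B ∣) C (r ∸ i))) ≡ sum1 (s ⊓ (r ∸ 1)) (g n)
    sum1≡ = trans (cong (λ b → sum1 (1 + q) (λ i → (b C i) * ((n ∸ b) C (r ∸ i)))) ∣B∣≡s) (sum1-g n)

  fewEdgesCase : ∀ n → n₀ ≤ n → s′ * (n C suc q) + s * r * (r * s * (n C q)) ≤ sum1 (s ⊓ (r ∸ 1)) (g n)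
  fewEdgesCase n n₀≤n = begin
    s′ * (n C suc q) + s * r * (r * s * (n C q))  ≡⟨ cong (λ n → s′ * (n C suc q) + s * r * (r * s * (n C q))) n≡s+m ⟩
    s′ * ((s + m′) C suc q) + s * r * (r * s * ((s + m′) C q))
                                                  ≤⟨ fewEdges≤ q s′ m′ big ⟩
    s * (m′ C suc q)                              ≡⟨ cong (_* (m′ C suc q)) (nC1≡n s) ⟨
    g n 1                                         ≤⟨ g1≤sum1 (1 + q) (g n) (s≤s z≤n) ⟩
    sum1 (1 + q) (g n)                            ≡⟨ sum1-g n ⟩
    sum1 (s ⊓ (r ∸ 1)) (g n)                      ∎
    where
    open ≤-Reasoning
    m′ : ℕ
    m′ = n ∸ s
    n≡s+m : n ≡ s + m′
    n≡s+m = sym (m+[n∸m]≡n (≤-trans (m≤m+n s _) n₀≤n))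
    big : roomForAsymptotics ≤ m′
    big = ≤-trans (m≤n+m roomForAsymptotics roomForMissing) (≤-trans (≤-reflexive (sym (m+n∸m≡n s _))) (∸-monoˡ-≤ s n₀≤n))

  upperBound : ∀ n → n₀ ≤ n → ∀ (H : Hypergraph n) → RGraph r H → FreeOfFAndMatching r s F H →
               e H ≤ a + sum1 (s ⊓ (r ∸ 1)) (g n)
  upperBound n n₀≤n H H-rGraph (H-¬F , H-¬Matching) with HeavyVertices.dichotomy q s H H-rGraph H-¬Matching
  ... | inj₁ (∣B∣≡s , covered) = coveredCase n n₀≤n H H-rGraph H-¬F _ ∣B∣≡s covered
  ... | inj₂ few               = ≤-trans few (≤-trans (fewEdgesCase n n₀≤n) (m≤n+m _ a))

theorem1p4 : (r s m : ℕ) → 2 ≤ r → 1 ≤ s →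
    (F : Hypergraph m) → RGraph r F → ChromaticGreaterThan F 2 →
    ∃[ n₀ ] (∀ n → n ≥ n₀ →
      ∃[ a ] (IsEx r s (FreeOfDeletions F) a ×
              IsEx r n (FreeOfFAndMatching r s F)
                (a + sum1 (s ⊓ (r ∸ 1)) (λ i → (s C i) * ((n ∸ s) C (r ∸ i))))))
theorem1p4 (suc zero)    _        m (s≤s ()) _ F _ _
theorem1p4 (suc (suc q)) (suc s′) m _ _ F (F-uniform , _) χF>2 with ex-FreeOfDeletions (2 + q) s′ F χF>2
... | a , isEx = n₀ , λ n n₀≤n →
  a , isEx , lowerBound (2 + q) (suc s′) n F (s≤s z≤n) (≤-trans (m≤m+n (suc s′) _) n₀≤n) (proj₁ isEx) , upperBound n n₀≤n
  where open UpperBound q s′ F F-uniform isEx
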